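{- Let $k\geq 3$ be an odd integer and let $H\in \mathcal{D}_k\setminus \mathcal{D}_{k-2}$ be a basic tournament. Then the following assertions are equivalent: (i) $H$ is a strong CR tournament. (ii) Every transitive blowup of $H$ is a CR tournament. (iii) For every tournament $T$: $T\in \xi(H)\cap(\mathcal{D}_k\setminus\mathcal{D}_{k-2})$ if and only if $T$ is switching equivalent to a transitive blowup of $H$.
   Context: A tournament is a digraph with exactly one arc between each pair of distinct vertices; an $n$-tournament has $n$ vertices. For distinct vertices $u,v$ of $T$ write $\theta_T(u,v)=1$ if $u\to v$ and $\theta_T(u,v)=-1$ if $v\to u$. The skew-adjacency matrix $S_T=[s_{ij}]$ (w.r.t. a vertex ordering $v_1,\dots,v_n$) has $s_{ij}=1$ if $v_i\to v_j$, $-1$ if $v_j\to v_i$, $0$ if $i=j$; $\det(T)=\det(S_T)$. For nonempty $X\subseteq V(T)$, $T[X]$ is the induced subtournament. For odd $k\geq1$, $\mathcal{D}_k$ is the set of tournaments all of whose subtournaments have determinant at most $k^2$; $\mathcal{D}_{ -1}=\emptyset$, and $T\in\mathcal{D}_k\setminus\mathcal{D}_{k-2}$ means $T\in\mathcal{D}_k$, $T\notin\mathcal{D}_{k-2}$. The switch of $T$ with respect to $W\subseteq V(T)$ is obtained by reversing all arcs between $W$ and $V(T)\setminus W$; $T$ and its switches are called switching equivalent. $T_1$ is switching isomorphic to $T_2$ if some switch of $T_1$ is isomorphic to $T_2$. For a tournament $H$, $\xi(H)$ is the set of tournaments containing a subtournament switching isomorphic to $H$. Blowups: if $T$ has vertices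 $v_1,\dots,v_n$ and $H_1,\dots,H_n$ are tournaments, $T(H_1,\dots,H_n)$ replaces each $v_i$ by $H_i$, with $V(H_i)\to V(H_j)$ (all arcs) whenever $v_i\to v_j$. If all $H_i$ are transitive (acyclic) with $|V(H_i)|=a_i$, this is the transitive blowup $T(a_1,\dots,a_n)$; if moreover one $a_i=2$ and all others equal $1$, it is a 1-transitive blowup. "$T$ is switching equivalent to a transitive blowup of $H$" means some switch of $T$ is (isomorphic to) a transitive blowup of $H$. A diamond is a 4-tournament consisting of a 3-cycle together with a vertex dominating all its vertices or dominated by all its vertices. CR notions: two vertices $u_1,u_2$ of $T$ are covertices and also revertices if $|V(T)|=2$; if $|V(T)|\ge3$ they are covertices if $\theta_T(u_1,v)=\theta_T(u_2,v)$ for all $v\ne u_1,u_2$, and revertices if $\theta_T(u_1,v)=-\theta_T(u_2,v)$ for all such $v$; they are CR-associated if they are covertices or revertices. For $u\notin V(T)=\{v_1,\dots,v_n\}$ and $\sigma=(r_1,\dots,r_n)\in\{1,-1\}^n$, $T(u,\sigma)$ is the tournament on $V(T)\cup\{u\}$ extending $T$ with $u\to v_i$ iff $r_i=1$. $u$ is a CR vertex for $T$ with $\sigma$ if some $v\in V(T)$ and $u$ are CR-associated in $T(u,\sigma)$; otherwise $u$ is a non-CR vertex for $T$ with $\sigma$. Let $T\in\mathcal{D}_k\setminus\mathcal{D}_{k-2}$ for an odd $k$. $T$ is a CR tournament if either $T$ is a 1-tournament, a 2-tournament or a diamond, or else for every $u\notin V(T)$ and every $\sigma$ such that $u$ is a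 non-CR vertex for $T$ with $\sigma$, we have $T(u,\sigma)\notin\mathcal{D}_k$. A CR tournament is a strong CR tournament if every 1-transitive blowup of it is a CR tournament. A tournament of order $n\ge4$ is basic if no two of its vertices are CR-associated. -}

module Defs where

open import Data.Nat using (ℕ; zero; suc; _*_; _∸_; _≤_)
open import Data.Bool using (Bool; true; false; not; _xor_; if_then_else_)
open import Data.Bool.Properties using (not-involutive)
open import Data.Fin using (Fin; zero; suc; toℕ; punchIn)
open import Data.Fin.Properties using (suc-injective)
open import Data.Integer using (ℤ; +_; -_) renaming (_+_ to _+ℤ_; _*_ to _*ℤ_; _≤_ to _≤ℤ_)
open import Data.Product using (Σ; ∃; ∃-syntax; _×_; _,_)
open import Data.Sum using (_⊎_)
open import Data.Empty using (⊥-elim)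
open import Relation.Nullary using (¬_; yes; no)
open import Relation.Binary.PropositionalEquality using (_≡_; _≢_; refl; cong; sym)
open import Function.Bundles using (_↔_; Inverse)
open import Function.Definitions using (Injective)
import Data.Fin as F

-- Tournaments on the vertex set Fin n.
-- arc i j ≡ true  means  i → j.

record Tournament (n : ℕ) : Set where
  field
    arc     : Fin n → Fin n → Bool
    irrefl  : ∀ i → arc i i ≡ false
    antisym : ∀ i j → i ≢ j → arc j i ≡ not (arc i j)
open Tournament public

Matrix : ℕ → Set
Matrix n = Fin n → Fin n → ℤ

sumFin : ∀ {n} → (Fin n → ℤ) → ℤ
sumFin {zero}  f = + 0
sumFin {suc n} f = f zero +ℤ sumFin (λ i → f (suc i))

signFin : ∀ {n} → Fin n → ℤ
signFin zero    = + 1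
signFin (suc i) = - signFin i

det : ∀ {n} → Matrix n → ℤ
det {zero}  M = + 1
det {suc n} M =
  sumFin (λ j → signFin j *ℤ (M zero j *ℤ det (λ r c → M (suc r) (punchIn j c))))

skew : ∀ {n} → Tournament n → Matrix n
skew T i j with i F.≟ j
... | yes _ = + 0
... | no  _ = if arc T i j then + 1 else - (+ 1)

detT : ∀ {n} → Tournament n → ℤ
detT T = det (skew T)

-- Induced subtournaments (a nonempty vertex subset given by an
-- injective map Fin (suc m) → Fin n; the determinant does not depend
-- on the chosen ordering of the subset).

induced : ∀ {m n} (T : Tournament n) (f : Fin m → Fin n) →
          Injective _≡_ _≡_ f → Tournament m
induced T f inj = record
  { arc     = λ i j → arc T (f i) (f j)
  ; irrefl  = λ i → irrefl T (f i)
  ; antisym = λ i j i≢j → antisym T (f i) (f j) (λ e → i≢j (inj e))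
  }

InD : ℕ → ∀ {n} → Tournament n → Set
InD k {n} T = ∀ {m} (f : Fin (suc m) → Fin n) (inj : Injective _≡_ _≡_ f) →
              detT (induced T f inj) ≤ℤ + (k * k)

Odd : ℕ → Set
Odd k = ∃[ j ] k ≡ suc (2 * j)

-- T ∈ D_k ∖ D_{k-2}  (with D_{-1} = ∅, i.e. for k = 1 this is just D_1).
InLevel : ℕ → ∀ {n} → Tournament n → Set
InLevel k T = InD k T × (k ≡ 1 ⊎ ¬ InD (k ∸ 2) T)

Iso : ∀ {n m} → Tournament n → Tournament m → Set
Iso {n} {m} T₁ T₂ =
  Σ (Fin n ↔ Fin m) λ π →
    ∀ i j → arc T₂ (Inverse.to π i) (Inverse.to π j) ≡ arc T₁ i j

private
  xx≡false : ∀ b → (b xor b) ≡ false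
  xx≡false true  = refl
  xx≡false false = refl

  sw-antisym : ∀ a b c d → d ≡ not c → ((b xor a) xor d) ≡ not ((a xor b) xor c)
  sw-antisym true  true  c d e = e
  sw-antisym true  false c d e = cong not e
  sw-antisym false true  c d e = cong not e
  sw-antisym false false c d e = e

switch : ∀ {n} → Tournament n → (Fin n → Bool) → Tournament n
switch T W = record
  { arc     = λ i j → (W i xor W j) xor arc T i j
  ; irrefl  = λ i → helper i
  ; antisym = λ i j i≢j → sw-antisym (W i) (W j) (arc T i j) (arc T j i) (antisym T i j i≢j)
  }
  where
  helper : ∀ i → ((W i xor W i) xor arc T i i) ≡ false
  helper i rewrite xx≡false (W i) = irrefl T i

SwitchIso : ∀ {n m} → Tournament n → Tournament m → Set
SwitchIso {n} T H = ∃[ W ] Iso (switch T W) H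

Xi : ∀ {m} → Tournament m → ∀ {n} → Tournament n → Set
Xi {m} H {n} T = Σ (Fin m → Fin n) λ f → Σ (Injective _≡_ _≡_ f) λ inj →
                   SwitchIso (induced T f inj) H

-- T (on Fin m) is (isomorphic to) a transitive
-- blowup T(a₁,…,aₙ) of H (on Fin n): there is a surjection p onto the
-- vertices of H (fibres = the blown-up parts, of sizes aᵢ ≥ 1), arcs
-- between different parts follow H, and each part induces a transitive
-- tournament.

IsTransBlowup : ∀ {m} → Tournament m → ∀ {n} → Tournament n → Set
IsTransBlowup {m} T {n} H =
  Σ (Fin m → Fin n) λ p →
    (∀ i → ∃[ x ] p x ≡ i) ×
    (∀ x y → p x ≢ p y → arc T x y ≡ arc H (p x) (p y)) ×
    (∀ x y z → p x ≡ p y → p y ≡ p z →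
       arc T x y ≡ true → arc T y z ≡ true → arc T x z ≡ true)

-- 1-transitive blowup: one part of size 2, all others of size 1
-- (equivalently, a transitive blowup with exactly one more vertex).
IsOneTransBlowup : ∀ {m} → Tournament m → ∀ {n} → Tournament n → Set
IsOneTransBlowup {m} T {n} H = m ≡ suc n × IsTransBlowup T H

SwEqTransBlowup : ∀ {m} → Tournament m → ∀ {n} → Tournament n → Set
SwEqTransBlowup T H = ∃[ W ] IsTransBlowup (switch T W) H

Covertices : ∀ {n} → Tournament n → Fin n → Fin n → Set
Covertices T u₁ u₂ = u₁ ≢ u₂ ×
  (∀ v → v ≢ u₁ → v ≢ u₂ → arc T u₁ v ≡ arc T u₂ v)

Revertices : ∀ {n} → Tournament n → Fin n → Fin n → Set
Revertices T u₁ u₂ = u₁ ≢ u₂ ×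
  (∀ v → v ≢ u₁ → v ≢ u₂ → arc T u₁ v ≡ not (arc T u₂ v))

CRAssoc : ∀ {n} → Tournament n → Fin n → Fin n → Set
CRAssoc T u₁ u₂ = Covertices T u₁ u₂ ⊎ Revertices T u₁ u₂

extend : ∀ {n} → Tournament n → (Fin n → Bool) → Tournament (suc n)
extend {n} T σ = record { arc = a ; irrefl = ir ; antisym = as }
  where
  a : Fin (suc n) → Fin (suc n) → Bool
  a zero    zero    = false
  a zero    (suc j) = σ j
  a (suc i) zero    = not (σ i)
  a (suc i) (suc j) = arc T i j
  ir : ∀ i → a i i ≡ false
  ir zero    = refl
  ir (suc i) = irrefl T i
  as : ∀ i j → i ≢ j → a j i ≡ not (a i j)
  as zero    zero    ne = ⊥-elim (ne refl)
  as zero    (suc j) ne = refl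
  as (suc i) zero    ne = sym (not-involutive (σ i))
  as (suc i) (suc j) ne = antisym T i j (λ e → ne (cong suc e))

CRVertex : ∀ {n} → Tournament n → (Fin n → Bool) → Set
CRVertex T σ = ∃[ v ] CRAssoc (extend T σ) zero (suc v)

IsDiamond : ∀ {n} → Tournament n → Set
IsDiamond {n} T = n ≡ 4 × ∃[ v ] ∃[ a ] ∃[ b ] ∃[ c ]
  (v ≢ a × v ≢ b × v ≢ c × a ≢ b × a ≢ c × b ≢ c) ×
  (arc T a b ≡ true × arc T b c ≡ true × arc T c a ≡ true) ×
  ((arc T v a ≡ true × arc T v b ≡ true × arc T v c ≡ true) ⊎
   (arc T a v ≡ true × arc T b v ≡ true × arc T c v ≡ true))

-- The CR condition relative to the (unique) odd k with T ∈ D_k ∖ D_{k-2}.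
CRCond : ℕ → ∀ {n} → Tournament n → Set
CRCond k {n} T = n ≡ 1 ⊎ n ≡ 2 ⊎ IsDiamond T ⊎
  (∀ σ → ¬ CRVertex T σ → ¬ InD k (extend T σ))

IsCR : ∀ {n} → Tournament n → Set
IsCR T = ∃[ k ] Odd k × InLevel k T × CRCond k T

IsStrongCR : ∀ {n} → Tournament n → Set
IsStrongCR {n} T = IsCR T ×
  (∀ {m} (T' : Tournament m) → IsOneTransBlowup T' T → IsCR T')

AllTransBlowupsCR : ∀ {n} → Tournament n → Set
AllTransBlowupsCR H = ∀ {m} (T : Tournament m) → IsTransBlowup T H → IsCR T

IsBasic : ∀ {n} → Tournament n → Set
IsBasic {n} T = 4 ≤ n × (∀ u₁ u₂ → ¬ CRAssoc T u₁ u₂)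

{-# OPTIONS --safe #-}
-- A transitive blowup of H stays in D_k, because deleting one of two covertices does not change
-- the determinant of any subtournament containing both, and it contains H, so it lies in
-- D_k ∖ D_{k-2}.  The heart of the proof: if all 1-transitive blowups of the basic tournament H are
-- CR, then so is every transitive blowup T.  For a one-vertex extension of T inside D_k, the CR
-- witness on a transversal of the parts and the witnesses on the 1-transitive blowups spanned by the
-- transversal and one further vertex (unique, since H is basic) assemble to a CR witness in T.
-- Conversely, a tournament in D_k containing a switch of H is rebuilt one vertex at a time: each new
-- vertex is a CR vertex of the blowup found so far, hence after switching a covertex, which enlarges
-- the blowup.  Finally, under (iii) a non-CR extension of a blowup inside D_k is switching
-- equivalent to a blowup of H in which either the new vertex has a covertex or two vertices of the
-- copy of H share a part; both contradict the assumptions.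

module Submission where

open import Defs
open import Data.Nat as ℕ using (ℕ; zero; suc; _≤_; _<_; _∸_; s≤s; z≤n)
import Data.Nat.Properties as ℕP
open import Data.Fin using (Fin; zero; suc; punchIn; punchOut; _≟_)
open import Data.Fin.Properties using (suc-injective; punchIn-punchOut; punchOut-punchIn; punchInᵢ≢i; punchOut-cong; punchIn-injective; punchOut-injective; any?; all?; ¬∀⟶∃¬; <⇒notInjective)
open import Data.Fin.Induction using (spo-wellFounded)
open import Data.Fin.Permutation using (Permutation; _⟨$⟩ʳ_; _⟨$⟩ˡ_; inverseˡ; inverseʳ; insert; id)
open import Data.Integer using (ℤ; +_; -_; _+_; _*_; _-_; 0ℤ; 1ℤ; -1ℤ; +≤+) renaming (_≤_ to _≤ℤ_)
import Data.Integer.Properties as ℤP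
open import Data.Integer.Tactic.RingSolver using (solve-∀)
open import Data.Bool using (Bool; true; false; not; if_then_else_; _xor_)
import Data.Bool.Properties as BoolP
open import Data.Empty using (⊥; ⊥-elim)
open import Data.Product using (∃-syntax; ∃₂; _×_; _,_; proj₁; proj₂)
open import Data.Sum using (_⊎_; inj₁; inj₂)
open import Induction.WellFounded using (Acc; acc)
open import Relation.Nullary using (¬_; Dec; yes; no; does; ¬?; _×-dec_; _→-dec_)
open import Relation.Nullary.Decidable using (dec-true; dec-false)
open import Relation.Unary using (Decidable)
open import Relation.Binary using (IsStrictPartialOrder; tri<; tri≈; tri>)
open import Relation.Binary.PropositionalEquality
open import Function using (_∘_)
open import Function.Bundles using (Inverse; _↔_; _⇔_; mk⇔; Equivalence)
open import Function.Construct.Identity using (↔-id)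
open import Function.Definitions using (Injective)

open ≡-Reasoning

-- Finite sums and determinants

sumFin-cong : ∀ {n} {f g : Fin n → ℤ} → (∀ i → f i ≡ g i) → sumFin f ≡ sumFin g
sumFin-cong {zero}  f≗g = refl
sumFin-cong {suc n} f≗g = cong₂ _+_ (f≗g zero) (sumFin-cong (f≗g ∘ suc))

sumFin-zero : ∀ {n} {f : Fin n → ℤ} → (∀ i → f i ≡ 0ℤ) → sumFin f ≡ 0ℤ
sumFin-zero {zero}  f≗0 = refl
sumFin-zero {suc n} f≗0 = cong₂ _+_ (f≗0 zero) (sumFin-zero (f≗0 ∘ suc))

sumFin-+ : ∀ {n} (f g : Fin n → ℤ) → sumFin (λ i → f i + g i) ≡ sumFin f + sumFin g
sumFin-+ {zero}  f g = refl
sumFin-+ {suc n} f g =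
  trans (cong (_+_ (f zero + g zero)) (sumFin-+ (f ∘ suc) (g ∘ suc))) (interchange (f zero) (g zero) _ _)
  where
  interchange : ∀ a b c d → (a + b) + (c + d) ≡ (a + c) + (b + d)
  interchange = solve-∀

sumFin-neg : ∀ {n} (f : Fin n → ℤ) → sumFin (λ i → - f i) ≡ - sumFin f
sumFin-neg {zero}  f = refl
sumFin-neg {suc n} f =
  trans (cong (_+_ (- f zero)) (sumFin-neg (f ∘ suc))) (sym (ℤP.neg-distrib-+ (f zero) (sumFin (f ∘ suc))))

sumFin-- : ∀ {n} (f g : Fin n → ℤ) → sumFin (λ i → f i - g i) ≡ sumFin f - sumFin g
sumFin-- f g = trans (sumFin-+ f (λ i → - g i)) (cong (_+_ (sumFin f)) (sumFin-neg g))

sumFin-*ˡ : ∀ {n} (c : ℤ) (f : Fin n → ℤ) → c * sumFin f ≡ sumFin (λ i → c * f i)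
sumFin-*ˡ {zero}  c f = ℤP.*-zeroʳ c
sumFin-*ˡ {suc n} c f =
  trans (ℤP.*-distribˡ-+ c (f zero) (sumFin (f ∘ suc))) (cong (_+_ (c * f zero)) (sumFin-*ˡ c (f ∘ suc)))

sumFin-swap : ∀ {m n} (f : Fin m → Fin n → ℤ) →
  sumFin (λ i → sumFin (λ j → f i j)) ≡ sumFin (λ j → sumFin (λ i → f i j))
sumFin-swap {zero} {n} f = sym (sumFin-zero {n} (λ _ → refl))
sumFin-swap {suc m} f = trans (cong (_+_ (sumFin (f zero))) (sumFin-swap (f ∘ suc)))
  (sym (sumFin-+ (f zero) (λ j → sumFin (λ i → f (suc i) j))))

sumFin-punchIn : ∀ {n} (c : Fin (suc n)) (f : Fin (suc n) → ℤ) →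
  sumFin f ≡ f c + sumFin (f ∘ punchIn c)
sumFin-punchIn zero    f = refl
sumFin-punchIn {suc n} (suc c) f =
  trans (cong (_+_ (f zero)) (sumFin-punchIn c (f ∘ suc))) (left-comm (f zero) (f (suc c)) _)
  where
  left-comm : ∀ a b d → a + (b + d) ≡ b + (a + d)
  left-comm = solve-∀

punchIn-pair-comm : ∀ {n} (a b : Fin (suc (suc n))) (a≢b : a ≢ b) (b≢a : b ≢ a) (x : Fin n) →
  punchIn a (punchIn (punchOut a≢b) x) ≡ punchIn b (punchIn (punchOut b≢a) x)
punchIn-pair-comm zero    zero    a≢b _ x = ⊥-elim (a≢b refl)
punchIn-pair-comm zero    (suc b) _   _ x = refl
punchIn-pair-comm (suc a) zero    _   _ x = refl
punchIn-pair-comm {suc n} (suc a) (suc b) a≢b b≢a zero    = refl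
punchIn-pair-comm {suc n} (suc a) (suc b) a≢b b≢a (suc x) =
  cong suc (punchIn-pair-comm a b (a≢b ∘ cong suc) (b≢a ∘ cong suc) x)

neg-*-neg : ∀ x y → - x * - y ≡ x * y
neg-*-neg = solve-∀

-- The sign (-1)^(a + b') where b' is the index of b once a is deleted; exchanging the roles of a and b flips it.
signFin-punchOut-swap : ∀ {n} (a b : Fin (suc (suc n))) (a≢b : a ≢ b) (b≢a : b ≢ a) →
  signFin a * signFin (punchOut a≢b) ≡ - (signFin b * signFin (punchOut b≢a))
signFin-punchOut-swap zero zero a≢b _ = ⊥-elim (a≢b refl)
signFin-punchOut-swap zero (suc b) _ _ = lemma (signFin b)
  where
  lemma : ∀ s → 1ℤ * s ≡ - (- s * 1ℤ)
  lemma = solve-∀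
signFin-punchOut-swap (suc a) zero _ _ = lemma (signFin a)
  where
  lemma : ∀ s → - s * 1ℤ ≡ - (1ℤ * s)
  lemma = solve-∀
signFin-punchOut-swap {zero} (suc zero) (suc zero) a≢b _ = ⊥-elim (a≢b refl)
signFin-punchOut-swap {suc n} (suc a) (suc b) a≢b b≢a = begin
  - signFin a * - signFin (punchOut a≢b′)      ≡⟨ neg-*-neg (signFin a) _ ⟩
  signFin a * signFin (punchOut a≢b′)          ≡⟨ signFin-punchOut-swap a b a≢b′ b≢a′ ⟩
  - (signFin b * signFin (punchOut b≢a′))      ≡⟨ cong -_ (neg-*-neg (signFin b) _) ⟨
  - (- signFin b * - signFin (punchOut b≢a′))  ∎
  where
  a≢b′ : a ≢ b
  a≢b′ = a≢b ∘ cong suc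
  b≢a′ : b ≢ a
  b≢a′ = b≢a ∘ cong suc

signFin-square : ∀ {n} (i : Fin n) → signFin i * signFin i ≡ 1ℤ
signFin-square zero    = refl
signFin-square (suc i) = trans (neg-*-neg (signFin i) _) (signFin-square i)

signFin-punchIn : ∀ {n} (c : Fin (suc (suc n))) j →
  signFin (punchIn c j) * signFin (punchOut (punchInᵢ≢i c j)) ≡ - (signFin c * signFin j)
signFin-punchIn c j = trans (signFin-punchOut-swap (punchIn c j) c (punchInᵢ≢i c j) (punchInᵢ≢i c j ∘ sym))
  (cong (λ z → - (signFin c * signFin z)) (trans (punchOut-cong c refl) (punchOut-punchIn c)))

punchIn-punchIn-comm : ∀ {n} (c : Fin (suc (suc n))) j (y : Fin n) →
  punchIn (punchIn c j) (punchIn (punchOut (punchInᵢ≢i c j)) y) ≡ punchIn c (punchIn j y)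
punchIn-punchIn-comm c j y = trans (punchIn-pair-comm (punchIn c j) c (punchInᵢ≢i c j) (punchInᵢ≢i c j ∘ sym) y)
  (cong (λ z → punchIn c (punchIn z y)) (punchOut-punchIn c))

sumFin-*ˡ² : ∀ {m} a b (f : Fin m → ℤ) → a * (b * sumFin f) ≡ sumFin (λ i → a * (b * f i))
sumFin-*ˡ² a b f = trans (cong (a *_) (sumFin-*ˡ b f)) (sumFin-*ˡ a (λ i → b * f i))

sumFin-*ˡ³ : ∀ {m} a b d (f : Fin m → ℤ) → a * (b * (d * sumFin f)) ≡ sumFin (λ i → a * (b * (d * f i)))
sumFin-*ˡ³ a b d f = trans (cong (λ z → a * (b * z)) (sumFin-*ˡ d f)) (sumFin-*ˡ² a b (λ i → d * f i))

det-cong : ∀ {n} {M N : Matrix n} → (∀ i j → M i j ≡ N i j) → det M ≡ det N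
det-cong {zero}  M≗N = refl
det-cong {suc n} M≗N = sumFin-cong (λ j → cong₂ (λ x y → signFin j * (x * y)) (M≗N zero j)
  (det-cong (λ r c → M≗N (suc r) (punchIn j c))))

minor : ∀ {n} → Fin (suc n) → Fin (suc n) → Matrix (suc n) → Matrix n
minor r c M i j = M (punchIn r i) (punchIn c j)

-- From the first-row expansion defining det: expand each minor along column c and exchange the sums.
det-expand-column : ∀ {n} (M : Matrix (suc n)) (c : Fin (suc n)) →
  det M ≡ sumFin (λ r → signFin r * (signFin c * (M r c * det (minor r c M))))
det-expand-column {zero} M zero = lemma (M zero zero)
  where
  lemma : ∀ x → 1ℤ * (x * 1ℤ) + 0ℤ ≡ 1ℤ * (1ℤ * (x * 1ℤ)) + 0ℤ
  lemma = solve-∀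
det-expand-column {suc n} M c =
  trans (sumFin-punchIn c term) (cong₂ _+_ (lemma (signFin c) (M zero c) _) other-columns)
  where
  lemma : ∀ s m d → s * (m * d) ≡ 1ℤ * (s * (m * d))
  lemma = solve-∀
  term : Fin (suc (suc n)) → ℤ
  term j = signFin j * (M zero j * det (minor zero j M))
  -- position of column c once column (punchIn c j) is deleted
  c′ : Fin (suc n) → Fin (suc n)
  c′ j = punchOut (punchInᵢ≢i c j)
  D : Fin (suc n) → Fin (suc n) → ℤ
  D r j = det (λ x y → M (suc (punchIn r x)) (punchIn c (punchIn j y)))
  minor-expand : ∀ j → det (minor zero (punchIn c j) M) ≡
    sumFin (λ r → signFin r * (signFin (c′ j) * (M (suc r) c * D r j)))
  minor-expand j = trans (det-expand-column (minor zero (punchIn c j) M) (c′ j))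
    (sumFin-cong (λ r → cong₂ (λ u v → signFin r * (signFin (c′ j) * (u * v)))
      (cong (M (suc r)) (punchIn-punchOut (punchInᵢ≢i c j)))
      (det-cong (λ x y → cong (M (suc (punchIn r x))) (punchIn-punchIn-comm c j y)))))
  rearrange : ∀ p q s sc sj A B d → p * q ≡ - (sc * sj) →
    p * (A * (s * (q * (B * d)))) ≡ (- s) * (sc * (B * (sj * (A * d))))
  rearrange p q s sc sj A B d pq = trans (factor p q s A B d)
    (trans (cong (λ z → z * (A * (s * (B * d)))) pq) (spread s sc sj A B d))
    where
    factor : ∀ p q s A B d → p * (A * (s * (q * (B * d)))) ≡ (p * q) * (A * (s * (B * d)))
    factor = solve-∀
    spread : ∀ s sc sj A B d → - (sc * sj) * (A * (s * (B * d))) ≡ (- s) * (sc * (B * (sj * (A * d))))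
    spread = solve-∀
  E G : Fin (suc n) → Fin (suc n) → ℤ
  E r j = signFin r * (signFin (c′ j) * (M (suc r) c * D r j))
  G r j = signFin j * (M zero (punchIn c j) * D r j)
  other-columns : sumFin (term ∘ punchIn c) ≡
    sumFin (λ r → signFin (suc r) * (signFin c * (M (suc r) c * det (minor (suc r) c M))))
  other-columns = begin
    sumFin (term ∘ punchIn c)
      ≡⟨ sumFin-cong (λ j → cong (λ z → signFin (punchIn c j) * (M zero (punchIn c j) * z)) (minor-expand j)) ⟩
    sumFin (λ j → signFin (punchIn c j) * (M zero (punchIn c j) * sumFin (λ r → E r j)))
      ≡⟨ sumFin-cong (λ j → sumFin-*ˡ² (signFin (punchIn c j)) (M zero (punchIn c j)) (λ r → E r j)) ⟩
    sumFin (λ j → sumFin (λ r → signFin (punchIn c j) * (M zero (punchIn c j) * E r j)))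
      ≡⟨ sumFin-swap (λ j r → signFin (punchIn c j) * (M zero (punchIn c j) * E r j)) ⟩
    sumFin (λ r → sumFin (λ j → signFin (punchIn c j) * (M zero (punchIn c j) * E r j)))
      ≡⟨ sumFin-cong (λ r → sumFin-cong (λ j → rearrange (signFin (punchIn c j)) (signFin (c′ j)) (signFin r)
           (signFin c) (signFin j) (M zero (punchIn c j)) (M (suc r) c) (D r j) (signFin-punchIn c j))) ⟩
    sumFin (λ r → sumFin (λ j → (- signFin r) * (signFin c * (M (suc r) c * G r j))))
      ≡⟨ sumFin-cong (λ r → sumFin-*ˡ³ (- signFin r) (signFin c) (M (suc r) c) (G r)) ⟨
    sumFin (λ r → signFin (suc r) * (signFin c * (M (suc r) c * det (minor (suc r) c M))))
      ∎

_ᵀ : ∀ {n} → Matrix n → Matrix n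
(M ᵀ) i j = M j i

det-ᵀ : ∀ {n} (M : Matrix n) → det (M ᵀ) ≡ det M
det-ᵀ {zero}  M = refl
det-ᵀ {suc n} M = begin
  det (M ᵀ)
    ≡⟨ sumFin-cong (λ j → cong (λ x → signFin j * (M j zero * x)) (det-ᵀ (minor j zero M))) ⟩
  sumFin (λ r → signFin r * (M r zero * det (minor r zero M)))
    ≡⟨ sumFin-cong (λ r → lemma (signFin r) (M r zero) (det (minor r zero M))) ⟨
  sumFin (λ r → signFin r * (1ℤ * (M r zero * det (minor r zero M))))
    ≡⟨ det-expand-column M zero ⟨
  det M ∎
  where
  lemma : ∀ s m d → s * (1ℤ * (m * d)) ≡ s * (m * d)
  lemma = solve-∀

ifEq : ∀ {n} → Fin n → Fin n → ℤ → ℤ → ℤ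
ifEq i j x y = if does (i ≟ j) then x else y

ifEq-refl : ∀ {n} (i : Fin n) x y → ifEq i i x y ≡ x
ifEq-refl i x y = cong (if_then x else y) (dec-true (i ≟ i) refl)

ifEq-≢ : ∀ {n} {i j : Fin n} x y → i ≢ j → ifEq i j x y ≡ y
ifEq-≢ {i = i} {j} x y i≢j = cong (if_then x else y) (dec-false (i ≟ j) i≢j)

det₂ : (M : Matrix 2) → det M ≡ M zero zero * M (suc zero) (suc zero) - M zero (suc zero) * M (suc zero) zero
det₂ M = expand (M zero zero) (M zero (suc zero)) (M (suc zero) zero) (M (suc zero) (suc zero))
  where
  -- the left-hand side is det M unfolded
  expand : ∀ a b c d → 1ℤ * (a * (1ℤ * (d * 1ℤ) + 0ℤ)) + (-1ℤ * (b * (1ℤ * (c * 1ℤ) + 0ℤ)) + 0ℤ) ≡ a * d - b * c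
  expand = solve-∀

det₂-equal-columns : (M : Matrix 2) → (∀ i → M i zero ≡ M i (suc zero)) → det M ≡ 0ℤ
det₂-equal-columns M cols = begin
  det M                                                        ≡⟨ det₂ M ⟩
  M zero zero * M (suc zero) (suc zero) - M zero (suc zero) * M (suc zero) zero
    ≡⟨ cong₂ (λ x y → x * M (suc zero) (suc zero) - M zero (suc zero) * y) (cols zero) (cols (suc zero)) ⟩
  M zero (suc zero) * M (suc zero) (suc zero) - M zero (suc zero) * M (suc zero) (suc zero)
    ≡⟨ cancel (M zero (suc zero) * M (suc zero) (suc zero)) ⟩
  0ℤ ∎
  where
  cancel : ∀ x → x - x ≡ 0ℤ
  cancel = solve-∀

index-avoiding : ∀ {n} (a b : Fin (suc (suc (suc n)))) → ∃[ c ] c ≢ a × c ≢ b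
index-avoiding zero          zero          = suc zero , (λ ()) , (λ ())
index-avoiding zero          (suc zero)    = suc (suc zero) , (λ ()) , (λ ())
index-avoiding zero          (suc (suc b)) = suc zero , (λ ()) , (λ ())
index-avoiding (suc zero)    zero          = suc (suc zero) , (λ ()) , (λ ())
index-avoiding (suc zero)    (suc b)       = zero , (λ ()) , (λ ())
index-avoiding (suc (suc a)) zero          = suc zero , (λ ()) , (λ ())
index-avoiding (suc (suc a)) (suc b)       = zero , (λ ()) , (λ ())

det-equal-columns : ∀ {n} (M : Matrix n) {a b} → a ≢ b → (∀ i → M i a ≡ M i b) → det M ≡ 0ℤ
det-equal-columns {1} M {zero} {zero} a≢b _ = ⊥-elim (a≢b refl)
det-equal-columns {2} M {zero}     {zero}     a≢b _    = ⊥-elim (a≢b refl)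
det-equal-columns {2} M {suc zero} {suc zero} a≢b _    = ⊥-elim (a≢b refl)
det-equal-columns {2} M {zero}     {suc zero} _   cols = det₂-equal-columns M cols
det-equal-columns {2} M {suc zero} {zero}     _   cols = det₂-equal-columns M (sym ∘ cols)
det-equal-columns {suc (suc (suc n))} M {a} {b} a≢b cols =
  let c , c≢a , c≢b = index-avoiding a b in
  trans (det-expand-column M c) (sumFin-zero λ r →
    trans (cong (λ z → signFin r * (signFin c * (M r c * z)))
        (det-equal-columns (minor r c M) (a≢b ∘ punchOut-injective c≢a c≢b) λ i →
          trans (cong (M (punchIn r i)) (punchIn-punchOut c≢a))
            (trans (cols (punchIn r i)) (cong (M (punchIn r i)) (sym (punchIn-punchOut c≢b))))))
      (annihilate (signFin r) (signFin c) (M r c)))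
  where
  annihilate : ∀ x y z → x * (y * (z * 0ℤ)) ≡ 0ℤ
  annihilate = solve-∀

det-subtract-column : ∀ {n} (M N : Matrix (suc n)) {a b} → a ≢ b →
  (∀ i j → j ≢ a → N i j ≡ M i j) → (∀ i → N i a ≡ M i a - M i b) → det N ≡ det M
det-subtract-column {n} M N {a} {b} a≢b N-off-a N-at-a = begin
  det N                                              ≡⟨ expand N N-off-a ⟩
  expandWith (λ r → N r a)                           ≡⟨ sumFin-cong (λ r → cong (cofactor r) (N-at-a r)) ⟩
  expandWith (λ r → M r a - M r b)                   ≡⟨ sumFin-cong (λ r → linear r (M r a) (M r b)) ⟩
  sumFin (λ r → cofactor r (M r a) - cofactor r (M r b))
    ≡⟨ sumFin-- (λ r → cofactor r (M r a)) (λ r → cofactor r (M r b)) ⟩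
  expandWith (λ r → M r a) - expandWith (λ r → M r b)
    ≡⟨ cong₂ _-_ (expand M (λ _ _ _ → refl))
         (trans (expand Y Y-off-a) (sumFin-cong (λ r → cong (cofactor r) (ifEq-refl a (M r b) (M r a))))) ⟨
  det M - det Y                                      ≡⟨ cong (_-_ (det M)) (det-equal-columns Y a≢b Y-a≡Y-b) ⟩
  det M - 0ℤ                                         ≡⟨ ℤP.+-identityʳ (det M) ⟩
  det M ∎
  where
  cofactor : Fin (suc n) → ℤ → ℤ
  cofactor r x = signFin r * (signFin a * (x * det (minor r a M)))
  expandWith : (Fin (suc n) → ℤ) → ℤ
  expandWith v = sumFin (λ r → cofactor r (v r))
  expand : ∀ P → (∀ i j → j ≢ a → P i j ≡ M i j) → det P ≡ expandWith (λ r → P r a)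
  expand P P-off-a = trans (det-expand-column P a) (sumFin-cong (λ r → cong (λ z → signFin r * (signFin a * (P r a * z)))
    (det-cong (λ x y → P-off-a (punchIn r x) (punchIn a y) (punchInᵢ≢i a y)))))
  Y : Matrix (suc n)
  Y i j = ifEq j a (M i b) (M i j)
  Y-off-a : ∀ i j → j ≢ a → Y i j ≡ M i j
  Y-off-a i j j≢a = ifEq-≢ _ _ j≢a
  Y-a≡Y-b : ∀ i → Y i a ≡ Y i b
  Y-a≡Y-b i = trans (ifEq-refl a _ _) (sym (ifEq-≢ _ _ (a≢b ∘ sym)))
  linear : ∀ r x y → cofactor r (x - y) ≡ cofactor r x - cofactor r y
  linear r x y = distrib (signFin r) (signFin a) x y (det (minor r a M))
    where
    distrib : ∀ s t x y d → s * (t * ((x - y) * d)) ≡ s * (t * (x * d)) - s * (t * (y * d))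
    distrib = solve-∀

det-subtract-row : ∀ {n} (M N : Matrix (suc n)) {a b} → a ≢ b →
  (∀ i j → i ≢ a → N i j ≡ M i j) → (∀ j → N a j ≡ M a j - M b j) → det N ≡ det M
det-subtract-row M N a≢b N-off-a N-at-a = begin
  det N       ≡⟨ det-ᵀ N ⟨
  det (N ᵀ)   ≡⟨ det-subtract-column (M ᵀ) (N ᵀ) a≢b (λ i j → N-off-a j i) N-at-a ⟩
  det (M ᵀ)   ≡⟨ det-ᵀ M ⟩
  det M       ∎

det-sparse-column : ∀ {n} (M : Matrix (suc n)) (r c : Fin (suc n)) → (∀ i → i ≢ r → M i c ≡ 0ℤ) →
  det M ≡ signFin r * (signFin c * (M r c * det (minor r c M)))
det-sparse-column M r c column-c = begin
  det M                          ≡⟨ det-expand-column M c ⟩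
  sumFin term                    ≡⟨ sumFin-punchIn r term ⟩
  term r + sumFin (term ∘ punchIn r)
    ≡⟨ cong (_+_ (term r)) (sumFin-zero other-terms) ⟩
  term r + 0ℤ                    ≡⟨ ℤP.+-identityʳ (term r) ⟩
  term r ∎
  where
  term : Fin _ → ℤ
  term i = signFin i * (signFin c * (M i c * det (minor i c M)))
  annihilate : ∀ a b d → a * (b * (0ℤ * d)) ≡ 0ℤ
  annihilate = solve-∀
  other-terms : ∀ i → term (punchIn r i) ≡ 0ℤ
  other-terms i = trans (cong (λ x → signFin (punchIn r i) * (signFin c * (x * det (minor (punchIn r i) c M))))
    (column-c (punchIn r i) (punchInᵢ≢i r i))) (annihilate (signFin (punchIn r i)) (signFin c) (det (minor (punchIn r i) c M)))

det-sparse-row : ∀ {n} (M : Matrix (suc n)) (r c : Fin (suc n)) → (∀ j → j ≢ c → M r j ≡ 0ℤ) →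
  det M ≡ signFin r * (signFin c * (M r c * det (minor r c M)))
det-sparse-row M r c row-r = begin
  det M          ≡⟨ det-ᵀ M ⟨
  det (M ᵀ)      ≡⟨ det-sparse-column (M ᵀ) c r row-r ⟩
  signFin c * (signFin r * (M r c * det (minor r c M ᵀ)))
                 ≡⟨ cong (λ z → signFin c * (signFin r * (M r c * z))) (det-ᵀ (minor r c M)) ⟩
  signFin c * (signFin r * (M r c * det (minor r c M)))
                 ≡⟨ swap (signFin c) (signFin r) (M r c) _ ⟩
  signFin r * (signFin c * (M r c * det (minor r c M))) ∎
  where
  swap : ∀ a b m d → a * (b * (m * d)) ≡ b * (a * (m * d))
  swap = solve-∀

prodFin : ∀ {n} → (Fin n → ℤ) → ℤ
prodFin {zero}  f = 1ℤ
prodFin {suc n} f = f zero * prodFin (f ∘ suc)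

det-scale-rows : ∀ {n} (ε : Fin n → ℤ) (M : Matrix n) → det (λ i j → ε i * M i j) ≡ prodFin ε * det M
det-scale-rows {zero}  ε M = refl
det-scale-rows {suc n} ε M = begin
  sumFin (λ j → signFin j * ((ε zero * M zero j) * det (λ r c → ε (suc r) * M (suc r) (punchIn j c))))
    ≡⟨ sumFin-cong (λ j → cong (λ z → signFin j * ((ε zero * M zero j) * z)) (det-scale-rows (ε ∘ suc) (minor zero j M))) ⟩
  sumFin (λ j → signFin j * ((ε zero * M zero j) * (prodFin (ε ∘ suc) * det (minor zero j M))))
    ≡⟨ sumFin-cong (λ j → regroup (signFin j) (ε zero) (M zero j) (prodFin (ε ∘ suc)) (det (minor zero j M))) ⟩
  sumFin (λ j → prodFin ε * (signFin j * (M zero j * det (minor zero j M))))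
    ≡⟨ sumFin-*ˡ (prodFin ε) (λ j → signFin j * (M zero j * det (minor zero j M))) ⟨
  prodFin ε * det M ∎
  where
  regroup : ∀ s e m p d → s * ((e * m) * (p * d)) ≡ (e * p) * (s * (m * d))
  regroup = solve-∀

det-scale-columns : ∀ {n} (ε : Fin n → ℤ) (M : Matrix n) → det (λ i j → M i j * ε j) ≡ prodFin ε * det M
det-scale-columns ε M = begin
  det (λ i j → M i j * ε j)     ≡⟨ det-ᵀ (λ i j → M i j * ε j) ⟨
  det (λ i j → M j i * ε i)     ≡⟨ det-cong (λ i j → ℤP.*-comm (M j i) (ε i)) ⟩
  det (λ i j → ε i * M j i)     ≡⟨ det-scale-rows ε (M ᵀ) ⟩
  prodFin ε * det (M ᵀ)         ≡⟨ cong (prodFin ε *_) (det-ᵀ M) ⟩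
  prodFin ε * det M             ∎

-- Subtracting row b from row a and then column b from column a leaves a single nonzero
-- entry in column a and then in row a, so both indices can be expanded away.
det-delete-twins : ∀ {n} (M : Matrix (suc (suc n))) {a b} (a≢b : a ≢ b) (b≢a : b ≢ a) →
  M a a ≡ 0ℤ → M b b ≡ 0ℤ → M b a ≡ - M a b → M a b * M a b ≡ 1ℤ →
  (∀ v → v ≢ a → v ≢ b → M a v ≡ M b v) → (∀ v → v ≢ a → v ≢ b → M v a ≡ M v b) →
  det M ≡ det (λ x y → M (punchIn a (punchIn (punchOut a≢b) x)) (punchIn a (punchIn (punchOut a≢b) y)))
det-delete-twins {n} M {a} {b} a≢b b≢a Maa Mbb Mba Mab² rows cols = begin
  det M                                  ≡⟨ det-subtract-row M N₁ a≢b (λ i j → ifEq-≢ _ _) (λ j → ifEq-refl a _ _) ⟨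
  det N₁                                 ≡⟨ det-subtract-column N₁ N₂ a≢b (λ i j → ifEq-≢ _ _) (λ i → ifEq-refl a _ _) ⟨
  det N₂                                 ≡⟨ det-sparse-column N₂ b a column-a ⟩
  signFin b * (signFin a * (N₂ b a * det Q))
    ≡⟨ cong₂ (λ u v → signFin b * (signFin a * (u * v))) N₂ba (det-sparse-row Q a′ b′ row-a′) ⟩
  signFin b * (signFin a * ((- M a b - 0ℤ) * (signFin a′ * (signFin b′ * (Q a′ b′ * det (minor a′ b′ Q))))))
    ≡⟨ cong₂ (λ u v → signFin b * (signFin a * ((- M a b - 0ℤ) * (signFin a′ * (signFin b′ * (u * v))))))
         Qa′b′ minor-Q ⟩
  signFin b * (signFin a * ((- M a b - 0ℤ) * (signFin a′ * (signFin b′ * ((M a b - 0ℤ) * det Mᵒ)))))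
    ≡⟨ signs (signFin a) (signFin b) (signFin a′) (signFin b′) (M a b) (det Mᵒ)
         (signFin-punchOut-swap a b a≢b b≢a) Mab² (signFin-square b) (signFin-square a′) ⟩
  det Mᵒ ∎
  where
  a′ b′ : Fin (suc n)
  a′ = punchOut b≢a
  b′ = punchOut a≢b
  g : Fin n → Fin (suc (suc n))
  g x = punchIn a (punchIn b′ x)
  Mᵒ : Matrix n
  Mᵒ x y = M (g x) (g y)
  N₁ N₂ : Matrix (suc (suc n))
  N₁ i j = ifEq i a (M a j - M b j) (M i j)
  N₂ i j = ifEq j a (N₁ i a - N₁ i b) (N₁ i j)
  Q : Matrix (suc n)
  Q = minor b a N₂
  cancel : ∀ x → x - x ≡ 0ℤ
  cancel = solve-∀
  cancel′ : ∀ t → (0ℤ - - t) - (t - 0ℤ) ≡ 0ℤ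
  cancel′ = solve-∀
  column-a-at-a : N₂ a a ≡ 0ℤ
  column-a-at-a = begin
    N₂ a a                                     ≡⟨ ifEq-refl a _ _ ⟩
    N₁ a a - N₁ a b                            ≡⟨ cong₂ _-_ (ifEq-refl a _ _) (ifEq-refl a _ _) ⟩
    (M a a - M b a) - (M a b - M b b)          ≡⟨ cong₂ (λ u v → (u - M b a) - (M a b - v)) Maa Mbb ⟩
    (0ℤ - M b a) - (M a b - 0ℤ)                ≡⟨ cong (λ u → (0ℤ - u) - (M a b - 0ℤ)) Mba ⟩
    (0ℤ - - M a b) - (M a b - 0ℤ)              ≡⟨ cancel′ (M a b) ⟩
    0ℤ ∎
  column-a : ∀ i → i ≢ b → N₂ i a ≡ 0ℤ
  column-a i i≢b = by-cases (i ≟ a)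
    where
    by-cases : Dec (i ≡ a) → N₂ i a ≡ 0ℤ
    by-cases (yes refl) = column-a-at-a
    by-cases (no i≢a) = trans (ifEq-refl a _ _) (trans (cong₂ _-_ (ifEq-≢ _ _ i≢a) (ifEq-≢ _ _ i≢a))
      (trans (cong (_- M i b) (cols i i≢a i≢b)) (cancel (M i b))))
  N₂ba : N₂ b a ≡ - M a b - 0ℤ
  N₂ba = trans (ifEq-refl a _ _) (trans (cong₂ _-_ (ifEq-≢ _ _ b≢a) (ifEq-≢ _ _ b≢a)) (cong₂ _-_ Mba Mbb))
  row-a′ : ∀ y → y ≢ b′ → Q a′ y ≡ 0ℤ
  row-a′ y y≢b′ = begin
    N₂ (punchIn b a′) (punchIn a y)     ≡⟨ cong (λ z → N₂ z (punchIn a y)) (punchIn-punchOut b≢a) ⟩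
    N₂ a (punchIn a y)                  ≡⟨ ifEq-≢ _ _ (punchInᵢ≢i a y) ⟩
    N₁ a (punchIn a y)                  ≡⟨ ifEq-refl a _ _ ⟩
    M a (punchIn a y) - M b (punchIn a y)
      ≡⟨ cong (_- M b (punchIn a y)) (rows (punchIn a y) (punchInᵢ≢i a y) py≢b) ⟩
    M b (punchIn a y) - M b (punchIn a y) ≡⟨ cancel (M b (punchIn a y)) ⟩
    0ℤ ∎
    where
    py≢b : punchIn a y ≢ b
    py≢b e = y≢b′ (punchIn-injective a y b′ (trans e (sym (punchIn-punchOut a≢b))))
  Qa′b′ : Q a′ b′ ≡ M a b - 0ℤ
  Qa′b′ = trans (cong₂ N₂ (punchIn-punchOut b≢a) (punchIn-punchOut a≢b))
    (trans (ifEq-≢ _ _ b≢a) (trans (ifEq-refl a _ _) (cong (_-_ (M a b)) Mbb)))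
  minor-Q : det (minor a′ b′ Q) ≡ det Mᵒ
  minor-Q = det-cong (λ x y → trans (cong (λ z → N₂ z (g y)) (sym (punchIn-pair-comm a b a≢b b≢a x)))
    (trans (ifEq-≢ _ _ (punchInᵢ≢i a _)) (ifEq-≢ _ _ (punchInᵢ≢i a _))))
  signs : ∀ sa sb sa′ sb′ t X → sa * sb′ ≡ - (sb * sa′) → t * t ≡ 1ℤ → sb * sb ≡ 1ℤ → sa′ * sa′ ≡ 1ℤ →
    sb * (sa * ((- t - 0ℤ) * (sa′ * (sb′ * ((t - 0ℤ) * X))))) ≡ X
  signs sa sb sa′ sb′ t X sasb′ t² sb² sa′² = begin
    sb * (sa * ((- t - 0ℤ) * (sa′ * (sb′ * ((t - 0ℤ) * X)))))  ≡⟨ collect sa sb sa′ sb′ t X ⟩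
    - (sa * sb′) * (sb * (sa′ * ((t * t) * X)))                ≡⟨ cong (λ z → - z * (sb * (sa′ * ((t * t) * X)))) sasb′ ⟩
    - - (sb * sa′) * (sb * (sa′ * ((t * t) * X)))              ≡⟨ square sb sa′ t X ⟩
    (sb * sb) * ((sa′ * sa′) * ((t * t) * X))                  ≡⟨ cong₂ (λ u v → u * (v * ((t * t) * X))) sb² sa′² ⟩
    1ℤ * (1ℤ * ((t * t) * X))                                  ≡⟨ cong (λ u → 1ℤ * (1ℤ * (u * X))) t² ⟩
    1ℤ * (1ℤ * (1ℤ * X))                                       ≡⟨ unit X ⟩
    X ∎
    where
    collect : ∀ sa sb sa′ sb′ t X → sb * (sa * ((- t - 0ℤ) * (sa′ * (sb′ * ((t - 0ℤ) * X))))) ≡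
      - (sa * sb′) * (sb * (sa′ * ((t * t) * X)))
    collect = solve-∀
    square : ∀ sb sa′ t X → - - (sb * sa′) * (sb * (sa′ * ((t * t) * X))) ≡ (sb * sb) * ((sa′ * sa′) * ((t * t) * X))
    square = solve-∀
    unit : ∀ X → 1ℤ * (1ℤ * (1ℤ * X)) ≡ X
    unit = solve-∀

switchSign : Bool → ℤ
switchSign true  = -1ℤ
switchSign false = 1ℤ

switchSign-square : ∀ b → switchSign b * switchSign b ≡ 1ℤ
switchSign-square true  = refl
switchSign-square false = refl

skew-switch : ∀ {n} (T : Tournament n) (W : Fin n → Bool) i j →
  skew (switch T W) i j ≡ switchSign (W i) * (skew T i j * switchSign (W j))
skew-switch T W i j with i ≟ j
... | yes _ = diagonal (W i) (W j)
  where
  diagonal : ∀ x y → 0ℤ ≡ switchSign x * (0ℤ * switchSign y)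
  diagonal true  true  = refl
  diagonal true  false = refl
  diagonal false true  = refl
  diagonal false false = refl
... | no _ = off-diagonal (W i) (W j) (arc T i j)
  where
  off-diagonal : ∀ x y z → (if (x xor y) xor z then + 1 else - (+ 1)) ≡
    switchSign x * ((if z then + 1 else - (+ 1)) * switchSign y)
  off-diagonal true  true  true  = refl
  off-diagonal true  true  false = refl
  off-diagonal true  false true  = refl
  off-diagonal true  false false = refl
  off-diagonal false true  true  = refl
  off-diagonal false true  false = refl
  off-diagonal false false true  = refl
  off-diagonal false false false = refl

prodFin-square : ∀ {n} (f : Fin n → ℤ) → (∀ i → f i * f i ≡ 1ℤ) → prodFin f * prodFin f ≡ 1ℤ
prodFin-square {zero}  f f² = refl
prodFin-square {suc n} f f² = begin
  (f zero * prodFin (f ∘ suc)) * (f zero * prodFin (f ∘ suc))   ≡⟨ interchange (f zero) (prodFin (f ∘ suc)) ⟩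
  (f zero * f zero) * (prodFin (f ∘ suc) * prodFin (f ∘ suc))
    ≡⟨ cong₂ _*_ (f² zero) (prodFin-square (f ∘ suc) (f² ∘ suc)) ⟩
  1ℤ ∎
  where
  interchange : ∀ a p → (a * p) * (a * p) ≡ (a * a) * (p * p)
  interchange = solve-∀

detT-switch : ∀ {n} (T : Tournament n) (W : Fin n → Bool) → detT (switch T W) ≡ detT T
detT-switch T W = begin
  detT (switch T W)                       ≡⟨ det-cong (skew-switch T W) ⟩
  det (λ i j → ε i * (skew T i j * ε j))  ≡⟨ det-scale-rows ε (λ i j → skew T i j * ε j) ⟩
  P * det (λ i j → skew T i j * ε j)      ≡⟨ cong (P *_) (det-scale-columns ε (skew T)) ⟩
  P * (P * detT T)                        ≡⟨ reassoc P (detT T) ⟩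
  (P * P) * detT T                        ≡⟨ cong (_* detT T) (prodFin-square ε (switchSign-square ∘ W)) ⟩
  1ℤ * detT T                             ≡⟨ unit (detT T) ⟩
  detT T ∎
  where
  ε : _ → ℤ
  ε = switchSign ∘ W
  P : ℤ
  P = prodFin ε
  reassoc : ∀ p d → p * (p * d) ≡ (p * p) * d
  reassoc = solve-∀
  unit : ∀ d → 1ℤ * d ≡ d
  unit = solve-∀

-- Tournaments and the classes D_k

arcSign : Bool → ℤ
arcSign b = if b then + 1 else - (+ 1)

skew-diagonal : ∀ {n} (T : Tournament n) {i j} → i ≡ j → skew T i j ≡ 0ℤ
skew-diagonal T {i} {j} i≡j with i ≟ j
... | yes _   = refl
... | no  i≢j = ⊥-elim (i≢j i≡j)

skew-off-diagonal : ∀ {n} (T : Tournament n) {i j} → i ≢ j → skew T i j ≡ arcSign (arc T i j)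
skew-off-diagonal T {i} {j} i≢j with i ≟ j
... | yes i≡j = ⊥-elim (i≢j i≡j)
... | no  _   = refl

skew-antisym : ∀ {n} (T : Tournament n) i j → skew T j i ≡ - skew T i j
skew-antisym T i j = by-cases (i ≟ j)
  where
  arcSign-not : ∀ b → arcSign (not b) ≡ - arcSign b
  arcSign-not true  = refl
  arcSign-not false = refl
  by-cases : Dec (i ≡ j) → skew T j i ≡ - skew T i j
  by-cases (yes i≡j) = trans (skew-diagonal T (sym i≡j)) (cong -_ (sym (skew-diagonal T i≡j)))
  by-cases (no i≢j) = begin
    skew T j i                   ≡⟨ skew-off-diagonal T (i≢j ∘ sym) ⟩
    arcSign (arc T j i)          ≡⟨ cong arcSign (antisym T i j i≢j) ⟩
    arcSign (not (arc T i j))    ≡⟨ arcSign-not (arc T i j) ⟩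
    - arcSign (arc T i j)        ≡⟨ cong -_ (skew-off-diagonal T i≢j) ⟨
    - skew T i j                 ∎

skew-square : ∀ {n} (T : Tournament n) {i j} → i ≢ j → skew T i j * skew T i j ≡ 1ℤ
skew-square T {i} {j} i≢j = trans (cong (λ z → z * z) (skew-off-diagonal T i≢j)) (arcSign-square (arc T i j))
  where
  arcSign-square : ∀ b → arcSign b * arcSign b ≡ 1ℤ
  arcSign-square true  = refl
  arcSign-square false = refl

skew-cong : ∀ {n} {T₁ T₂ : Tournament n} → (∀ i j → arc T₁ i j ≡ arc T₂ i j) →
  ∀ i j → skew T₁ i j ≡ skew T₂ i j
skew-cong arcs i j with i ≟ j
... | yes _ = refl
... | no  _ = cong arcSign (arcs i j)

detT-cong : ∀ {n} {T₁ T₂ : Tournament n} → (∀ i j → arc T₁ i j ≡ arc T₂ i j) → detT T₁ ≡ detT T₂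
detT-cong = det-cong ∘ skew-cong

skew-induced : ∀ {n m} (T : Tournament n) (f : Fin m → Fin n) (f-inj : Injective _≡_ _≡_ f) i j →
  skew (induced T f f-inj) i j ≡ skew T (f i) (f j)
skew-induced T f f-inj i j with i ≟ j
... | yes i≡j = sym (skew-diagonal T (cong f i≡j))
... | no  i≢j = sym (skew-off-diagonal T (i≢j ∘ f-inj))

record Embedding {n m} (T₁ : Tournament n) (T₂ : Tournament m) : Set where
  constructor embedding
  field
    map       : Fin n → Fin m
    injective : Injective _≡_ _≡_ map
    arcs      : ∀ i j → arc T₁ i j ≡ arc T₂ (map i) (map j)

embedding-pointwise : ∀ {n} {T₁ T₂ : Tournament n} → (∀ i j → arc T₁ i j ≡ arc T₂ i j) → Embedding T₁ T₂
embedding-pointwise arcs = embedding (λ i → i) (λ e → e) arcs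

induced-embedding : ∀ {n m} (T : Tournament m) (f : Fin n → Fin m) (f-inj : Injective _≡_ _≡_ f) →
  Embedding (induced T f f-inj) T
induced-embedding T f f-inj = embedding f f-inj λ i j → refl

InD-embedding : ∀ k {n m} {T₁ : Tournament n} {T₂ : Tournament m} → Embedding T₁ T₂ → InD k T₂ → InD k T₁
InD-embedding k (embedding g g-inj g-arcs) T₂∈D f f-inj =
  ℤP.≤-trans (ℤP.≤-reflexive (detT-cong (λ i j → g-arcs (f i) (f j)))) (T₂∈D (g ∘ f) (f-inj ∘ g-inj))

InD-switch : ∀ k {n} (T : Tournament n) W → InD k T → InD k (switch T W)
InD-switch k T W T∈D f f-inj =
  ℤP.≤-trans (ℤP.≤-reflexive (trans (detT-cong {T₂ = switch (induced T f f-inj) (W ∘ f)} (λ _ _ → refl))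
    (detT-switch (induced T f f-inj) (W ∘ f)))) (T∈D f f-inj)

switch-involutive : ∀ {n} (T : Tournament n) W i j → arc (switch (switch T W) W) i j ≡ arc T i j
switch-involutive T W i j = cancel (W i) (W j) (arc T i j)
  where
  cancel : ∀ a b c → (a xor b) xor ((a xor b) xor c) ≡ c
  cancel true  true  c = refl
  cancel true  false c = BoolP.not-involutive c
  cancel false true  c = BoolP.not-involutive c
  cancel false false c = refl

InD-unswitch : ∀ k {n} (T : Tournament n) W → InD k (switch T W) → InD k T
InD-unswitch k T W switch∈D =
  InD-embedding k {T₁ = T} {T₂ = switch (switch T W) W} (embedding-pointwise (λ i j → sym (switch-involutive T W i j)))
    (InD-switch k (switch T W) W switch∈D)

delete : ∀ {n} → Tournament (suc n) → Fin (suc n) → Tournament n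
delete T a = induced T (punchIn a) (punchIn-injective a _ _)

module _ {k N} (k≥1 : 1 ≤ k) (T : Tournament (suc N)) {a b} (a-b-covertices : Covertices T a b)
         (T-a∈D : InD k (delete T a)) where

  private
    a≢b : a ≢ b
    a≢b = proj₁ a-b-covertices
    rows : ∀ v → v ≢ a → v ≢ b → arc T a v ≡ arc T b v
    rows = proj₂ a-b-covertices

    bounded : ∀ {x y} → x ≡ y → y ≤ℤ + (k ℕ.* k) → x ≤ℤ + (k ℕ.* k)
    bounded x≡y = ℤP.≤-trans (ℤP.≤-reflexive x≡y)

    avoiding-a : ∀ {m} (h : Fin m → Fin (suc N)) (h-inj : Injective _≡_ _≡_ h) → (∀ x → h x ≢ a) →
      detT (induced T h h-inj) ≤ℤ + (k ℕ.* k)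
    avoiding-a {zero}  h h-inj h≢a = +≤+ (ℕP.*-mono-≤ k≥1 k≥1)
    avoiding-a {suc m} h h-inj h≢a = bounded (detT-cong arcs) (T-a∈D h′ h′-inj)
      where
      a≢h : ∀ x → a ≢ h x
      a≢h x = h≢a x ∘ sym
      h′ : Fin (suc m) → Fin N
      h′ x = punchOut (a≢h x)
      h′-inj : Injective _≡_ _≡_ h′
      h′-inj {x} {y} = h-inj ∘ punchOut-injective (a≢h x) (a≢h y)
      arcs : ∀ i j → arc T (h i) (h j) ≡ arc T (punchIn a (h′ i)) (punchIn a (h′ j))
      arcs i j = sym (cong₂ (arc T) (punchIn-punchOut (a≢h i)) (punchIn-punchOut (a≢h j)))

    replace : Fin (suc N) → Fin (suc N)
    replace z = if does (z ≟ a) then b else z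

    replace-spec : ∀ z → (z ≡ a × replace z ≡ b) ⊎ (z ≢ a × replace z ≡ z)
    replace-spec z with z ≟ a
    ... | yes z≡a = inj₁ (z≡a , refl)
    ... | no  z≢a = inj₂ (z≢a , refl)

    missing-b : ∀ {m} (f : Fin (suc m) → Fin (suc N)) (f-inj : Injective _≡_ _≡_ f) → (∀ y → f y ≢ b) →
      detT (induced T f f-inj) ≤ℤ + (k ℕ.* k)
    missing-b f f-inj f≢b = bounded (detT-cong arcs) (avoiding-a (replace ∘ f) f′-inj f′≢a)
      where
      f′≢a : ∀ x → replace (f x) ≢ a
      f′≢a x with replace-spec (f x)
      ... | inj₁ (_ , e)   = λ e′ → a≢b (sym (trans (sym e) e′))
      ... | inj₂ (ne , e)  = λ e′ → ne (trans (sym e) e′)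
      f′-inj : Injective _≡_ _≡_ (replace ∘ f)
      f′-inj {x} {y} e with replace-spec (f x) | replace-spec (f y)
      ... | inj₁ (ex , _)  | inj₁ (ey , _)  = f-inj (trans ex (sym ey))
      ... | inj₁ (_ , sx)  | inj₂ (_ , sy)  = ⊥-elim (f≢b y (trans (sym sy) (trans (sym e) sx)))
      ... | inj₂ (_ , sx)  | inj₁ (_ , sy)  = ⊥-elim (f≢b x (trans (sym sx) (trans e sy)))
      ... | inj₂ (_ , sx)  | inj₂ (_ , sy)  = f-inj (trans (sym sx) (trans e sy))
      arcs : ∀ i j → arc T (f i) (f j) ≡ arc T (replace (f i)) (replace (f j))
      arcs i j with replace-spec (f i) | replace-spec (f j)
      ... | inj₁ (ei , si) | inj₁ (ej , sj) =
        trans (cong₂ (arc T) ei ej) (trans (irrefl T a) (sym (trans (cong₂ (arc T) si sj) (irrefl T b))))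
      ... | inj₁ (ei , si) | inj₂ (nj , sj) =
        trans (cong (λ z → arc T z (f j)) ei) (trans (rows (f j) nj (f≢b j)) (sym (cong₂ (arc T) si sj)))
      ... | inj₂ (ni , si) | inj₁ (ej , sj) = begin
        arc T (f i) (f j)     ≡⟨ cong (arc T (f i)) ej ⟩
        arc T (f i) a         ≡⟨ antisym T a (f i) (ni ∘ sym) ⟩
        not (arc T a (f i))   ≡⟨ cong not (rows (f i) ni (f≢b i)) ⟩
        not (arc T b (f i))   ≡⟨ antisym T b (f i) (f≢b i ∘ sym) ⟨
        arc T (f i) b         ≡⟨ cong₂ (arc T) si sj ⟨
        arc T (replace (f i)) (replace (f j)) ∎
      ... | inj₂ (_ , si)  | inj₂ (_ , sj)  = sym (cong₂ (arc T) si sj)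

    -- a and b are twins of the skew-adjacency matrix, so deleting both keeps the determinant.
    containing-both : ∀ {m} (f : Fin (suc m) → Fin (suc N)) (f-inj : Injective _≡_ _≡_ f) →
      ∀ {x y} → f x ≡ a → f y ≡ b → detT (induced T f f-inj) ≤ℤ + (k ℕ.* k)
    containing-both {zero}  f f-inj {zero} {zero} fx≡a fy≡b = ⊥-elim (a≢b (trans (sym fx≡a) fy≡b))
    containing-both {suc m} f f-inj {x} {y} fx≡a fy≡b =
      bounded (trans twins-deleted (det-cong λ p q → trans (skew-induced T f f-inj (g p) (g q))
          (sym (skew-induced T (f ∘ g) g-inj p q))))
        (avoiding-a (f ∘ g) g-inj (λ p e → punchInᵢ≢i x (punchIn (punchOut x≢y) p) (f-inj (trans e (sym fx≡a)))))
      where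
      S : Tournament (suc (suc m))
      S = induced T f f-inj
      x≢y : x ≢ y
      x≢y e = a≢b (trans (sym fx≡a) (trans (cong f e) fy≡b))
      g : Fin m → Fin (suc (suc m))
      g p = punchIn x (punchIn (punchOut x≢y) p)
      g-inj : Injective _≡_ _≡_ (f ∘ g)
      g-inj {p} {q} = punchIn-injective _ p q ∘ punchIn-injective x _ _ ∘ f-inj
      twin-rows : ∀ v → v ≢ x → v ≢ y → arc T (f x) (f v) ≡ arc T (f y) (f v)
      twin-rows v v≢x v≢y = trans (cong (λ z → arc T z (f v)) fx≡a)
        (trans (rows (f v) (λ e → v≢x (f-inj (trans e (sym fx≡a)))) (λ e → v≢y (f-inj (trans e (sym fy≡b)))))
          (cong (λ z → arc T z (f v)) (sym fy≡b)))
      skew-rows : ∀ v → v ≢ x → v ≢ y → skew S x v ≡ skew S y v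
      skew-rows v v≢x v≢y = trans (skew-off-diagonal S (v≢x ∘ sym))
        (trans (cong arcSign (twin-rows v v≢x v≢y)) (sym (skew-off-diagonal S (v≢y ∘ sym))))
      skew-columns : ∀ v → v ≢ x → v ≢ y → skew S v x ≡ skew S v y
      skew-columns v v≢x v≢y = trans (skew-antisym S x v)
        (trans (cong -_ (skew-rows v v≢x v≢y)) (sym (skew-antisym S y v)))
      twins-deleted : detT S ≡ det (λ p q → skew S (g p) (g q))
      twins-deleted = det-delete-twins (skew S) x≢y (x≢y ∘ sym) (skew-diagonal S {x} refl) (skew-diagonal S {y} refl)
        (skew-antisym S x y) (skew-square S x≢y) skew-rows skew-columns

  InD-undelete-covertex : InD k T
  InD-undelete-covertex f f-inj with any? (λ x → f x ≟ a)
  ... | no ∄x = avoiding-a f f-inj (λ x e → ∄x (x , e))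
  ... | yes (x , fx≡a) with any? (λ y → f y ≟ b)
  ...   | no ∄y         = missing-b f f-inj (λ y e → ∄y (y , e))
  ...   | yes (y , fy≡b) = containing-both f f-inj fx≡a fy≡b

-- Transitive blowups

module _ {m} {P : Fin m → Set} (P? : Decidable P) (R : Fin m → Fin m → Bool)
         (R-irrefl : ∀ x → R x x ≡ false)
         (R-trans : ∀ {x y z} → P x → P y → P z → R x y ≡ true → R y z ≡ true → R x z ≡ true) where

  private
    _⊏_ : Fin m → Fin m → Set
    x ⊏ y = P x × P y × R x y ≡ true

    ⊏-irrefl : ∀ {x y} → x ≡ y → ¬ x ⊏ y
    ⊏-irrefl {x} refl (_ , _ , Rxx) with trans (sym Rxx) (R-irrefl x)
    ... | ()

    ⊏-isStrictPartialOrder : IsStrictPartialOrder _≡_ _⊏_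
    ⊏-isStrictPartialOrder = record
      { isEquivalence = isEquivalence
      ; irrefl        = ⊏-irrefl
      ; trans         = λ (px , py , Rxy) (_ , pz , Ryz) → px , pz , R-trans px py pz Rxy Ryz
      ; <-resp-≈      = resp₂ _⊏_
      }

    descend : ∀ {x} → Acc _⊏_ x → P x → ∃[ b ] P b × (∀ z → P z → R z b ≡ false)
    descend {x} (acc below) px with any? (λ z → P? z ×-dec (R z x BoolP.≟ true))
    ... | yes (z , pz , Rzx) = descend (below (pz , px , Rzx)) pz
    ... | no ∄z = x , px , λ z pz → BoolP.¬-not (λ Rzx → ∄z (z , pz , Rzx))

  minimal-element : ∀ {x} → P x → ∃[ b ] P b × (∀ z → P z → R z b ≡ false)
  minimal-element {x} = descend (spo-wellFounded ⊏-isStrictPartialOrder x)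

TransBlowupMap : ∀ {m n} → Tournament m → Tournament n → (Fin m → Fin n) → Set
TransBlowupMap X H q =
  (∀ x y → q x ≢ q y → arc X x y ≡ arc H (q x) (q y)) ×
  (∀ x y z → q x ≡ q y → q y ≡ q z → arc X x y ≡ true → arc X y z ≡ true → arc X x z ≡ true)

transBlowupMap-induced : ∀ {m n l} {X : Tournament m} {H : Tournament n} {q : Fin m → Fin n} →
  TransBlowupMap X H q → (g : Fin l → Fin m) (g-inj : Injective _≡_ _≡_ g) →
  TransBlowupMap (induced X g g-inj) H (q ∘ g)
transBlowupMap-induced (between , within) g g-inj =
  (λ x y → between (g x) (g y)) , (λ x y z → within (g x) (g y) (g z))

opposite : ∀ {n} → Tournament n → Tournament n
opposite T = record
  { arc     = λ i j → arc T j i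
  ; irrefl  = irrefl T
  ; antisym = λ i j i≢j → antisym T j i (i≢j ∘ sym)
  }

transBlowupMap-opposite : ∀ {m n} {X : Tournament m} {H : Tournament n} {q} →
  TransBlowupMap X H q → TransBlowupMap (opposite X) (opposite H) q
transBlowupMap-opposite (between , within) =
  (λ x y qx≢qy → between y x (qx≢qy ∘ sym)) , (λ x y z qx≡qy qy≡qz yx zy → within z y x (sym qy≡qz) (sym qx≡qy) zy yx)

covertices-opposite : ∀ {n} {X : Tournament n} {u b} → Covertices (opposite X) u b → Covertices X u b
covertices-opposite {X = X} {u} {b} (u≢b , same) = u≢b , λ v v≢u v≢b →
  trans (antisym X v u v≢u) (trans (cong not (same v v≢u v≢b)) (sym (antisym X v b v≢b)))

private
  true≢false : true ≢ false
  true≢false ()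

arc⇒≢ : ∀ {n} (X : Tournament n) {x y} → arc X x y ≡ true → x ≢ y
arc⇒≢ X {x} Xxy refl = true≢false (trans (sym Xxy) (irrefl X x))

arc-asym : ∀ {n} (T : Tournament n) {x y} → arc T x y ≡ true → arc T y x ≡ true → ⊥
arc-asym T {x} {y} xy yx with trans (sym yx) (trans (antisym T x y (arc⇒≢ T xy)) (cong not xy))
... | ()

-- The first vertex after u in the transitive order of its part is a covertex of u.
successor-covertex : ∀ {m n} {X : Tournament m} {H : Tournament n} {q : Fin m → Fin n} → TransBlowupMap X H q →
  ∀ {u y} → arc X u y ≡ true → q u ≡ q y → ∃[ b ] q b ≡ q u × Covertices X u b
successor-covertex {X = X} {H} {q} (between , within) {u} {y} uy qu≡qy
  with minimal-element (λ z → (q z ≟ q u) ×-dec (arc X u z BoolP.≟ true)) (arc X) (irrefl X)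
         (λ (qx , _) (qy , _) (qz , _) → within _ _ _ (trans qx (sym qy)) (trans qy (sym qz)))
         {y} (sym qu≡qy , uy)
... | b , (qb≡qu , ub) , b-first = b , qb≡qu , arc⇒≢ X ub , covertex
  where
  covertex : ∀ v → v ≢ u → v ≢ b → arc X u v ≡ arc X b v
  covertex v v≢u v≢b with q v ≟ q u
  ... | no qv≢qu = trans (between u v (qv≢qu ∘ sym))
      (trans (cong (λ z → arc H z (q v)) (sym qb≡qu)) (sym (between b v (λ e → qv≢qu (trans (sym e) qb≡qu)))))
  ... | yes qv≡qu with arc X u v in uv
  ...   | true  = sym (trans (antisym X v b v≢b) (cong not (b-first v (qv≡qu , uv))))
  ...   | false = sym (trans (antisym X v b v≢b) (cong not
            (within v u b qv≡qu (sym qb≡qu) (trans (antisym X u v (v≢u ∘ sym)) (cong not uv)) ub)))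

covertex-in-part : ∀ {m n} {X : Tournament m} {H : Tournament n} {q : Fin m → Fin n} → TransBlowupMap X H q →
  ∀ {u y} → u ≢ y → q u ≡ q y → ∃[ b ] q b ≡ q u × Covertices X u b
covertex-in-part {X = X} {H} {q} blowup {u} {y} u≢y qu≡qy with arc X u y in uy
... | true  = successor-covertex {X = X} {H = H} {q = q} blowup uy qu≡qy
... | false with successor-covertex {X = opposite X} {H = opposite H} {q = q}
                 (transBlowupMap-opposite {X = X} {H = H} blowup) (trans (antisym X u y u≢y) (cong not uy)) qu≡qy
...   | b , qb≡qu , covertex = b , qb≡qu , covertices-opposite {X = X} covertex

transBlowupMap-embedding : ∀ {m n} {X : Tournament m} {H : Tournament n} {q} →
  TransBlowupMap X H q → Injective _≡_ _≡_ q → Embedding X H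
transBlowupMap-embedding {X = X} {H} {q} (between , _) q-inj = embedding q q-inj arcs
  where
  arcs : ∀ i j → arc X i j ≡ arc H (q i) (q j)
  arcs i j with i ≟ j
  ... | yes refl = trans (irrefl X i) (sym (irrefl H (q i)))
  ... | no  i≢j  = between i j (i≢j ∘ q-inj)

injective-or-collision : ∀ {m n} (q : Fin m → Fin n) → Injective _≡_ _≡_ q ⊎ ∃₂ λ x y → x ≢ y × q x ≡ q y
injective-or-collision q with any? (λ x → any? (λ y → ¬? (x ≟ y) ×-dec (q x ≟ q y)))
... | yes collision = inj₂ collision
... | no ∄collision = inj₁ injective
  where
  injective : Injective _≡_ _≡_ q
  injective {x} {y} qx≡qy with x ≟ y
  ... | yes x≡y = x≡y
  ... | no  x≢y = ⊥-elim (∄collision (x , y , x≢y , qx≡qy))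

-- Each collision of the blowup map yields a covertex, and deleting it stays inside a blowup of H.
InD-transBlowup : ∀ {k} → 1 ≤ k → ∀ {n} {H : Tournament n} → InD k H →
  ∀ {m} {X : Tournament m} {q} → TransBlowupMap X H q → InD k X
InD-transBlowup {k} k≥1 {H = H} H∈D {zero} {X} {q} blowup =
  InD-embedding k (transBlowupMap-embedding {X = X} {H} {q} blowup λ { {()} }) H∈D
InD-transBlowup {k} k≥1 {H = H} H∈D {suc m} {X} {q} blowup with injective-or-collision q
... | inj₁ q-inj = InD-embedding k (transBlowupMap-embedding {X = X} {H} {q} blowup q-inj) H∈D
... | inj₂ (x , y , x≢y , qx≡qy) with covertex-in-part {X = X} {H} {q} blowup x≢y qx≡qy
...   | b , _ , covertex = InD-undelete-covertex k≥1 X covertex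
  (InD-transBlowup k≥1 {H = H} H∈D {X = delete X x} {q ∘ punchIn x}
    (transBlowupMap-induced {X = X} {H} {q} blowup (punchIn x) (punchIn-injective x _ _)))

-- Levels and CR vertices

InD-mono : ∀ {k k′} → k ≤ k′ → ∀ {n} (T : Tournament n) → InD k T → InD k′ T
InD-mono k≤k′ T T∈D f f-inj = ℤP.≤-trans (T∈D f f-inj) (+≤+ (ℕP.*-mono-≤ k≤k′ k≤k′))

odd-<⇒≤∸2 : ∀ {k k′} → Odd k → Odd k′ → k < k′ → k ≤ k′ ∸ 2
odd-<⇒≤∸2 (j , refl) (zero , refl) (s≤s k<1) with ℕP.*-cancelˡ-< 2 j 0 k<1
... | ()
odd-<⇒≤∸2 (j , refl) (suc j′ , refl) (s≤s k<k′) =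
  subst (suc (2 ℕ.* j) ≤_) (sym (cong (λ x → suc x ∸ 2) (ℕP.*-suc 2 j′)))
    (s≤s (ℕP.*-monoʳ-≤ 2 (ℕP.≤-pred (ℕP.*-cancelˡ-< 2 j (suc j′) k<k′))))

InLevel-< : ∀ {k k′} → Odd k → Odd k′ → k < k′ → ∀ {n} (T : Tournament n) → InLevel k T → ¬ InLevel k′ T
InLevel-< (j , refl) k′-odd k<k′ T T∈k (_ , inj₁ refl) with ℕP.n<1⇒n≡0 k<k′
... | ()
InLevel-< k-odd k′-odd k<k′ T (T∈D , _) (_ , inj₂ T∉D′) = T∉D′ (InD-mono (odd-<⇒≤∸2 k-odd k′-odd k<k′) T T∈D)

InLevel-unique : ∀ {k k′} → Odd k → Odd k′ → ∀ {n} (T : Tournament n) → InLevel k T → InLevel k′ T → k ≡ k′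
InLevel-unique {k} {k′} k-odd k′-odd T T∈k T∈k′ with ℕP.<-cmp k k′
... | tri< k<k′ _ _ = ⊥-elim (InLevel-< k-odd k′-odd k<k′ T T∈k T∈k′)
... | tri≈ _ k≡k′ _ = k≡k′
... | tri> _ _ k>k′ = ⊥-elim (InLevel-< k′-odd k-odd k>k′ T T∈k′ T∈k)

InLevel-extension : ∀ {k n m} {H : Tournament n} {X : Tournament m} →
  InLevel k H → Embedding H X → InD k X → InLevel k X
InLevel-extension (_ , inj₁ k≡1) _ X∈D = X∈D , inj₁ k≡1
InLevel-extension {k} (_ , inj₂ H∉D) H↪X X∈D = X∈D , inj₂ (H∉D ∘ InD-embedding (k ∸ 2) H↪X)

section-embedding : ∀ {m n} {X : Tournament m} {H : Tournament n} {p : Fin m → Fin n} →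
  TransBlowupMap X H p → (s : Fin n → Fin m) → (∀ i → p (s i) ≡ i) → Embedding H X
section-embedding {X = X} {H} {p} (between , _) s ps = embedding s s-inj arcs
  where
  s-inj : ∀ {i j} → s i ≡ s j → i ≡ j
  s-inj {i} {j} si≡sj = trans (sym (ps i)) (trans (cong p si≡sj) (ps j))
  arcs : ∀ i j → arc H i j ≡ arc X (s i) (s j)
  arcs i j with i ≟ j
  ... | yes refl = trans (irrefl H i) (sym (irrefl X (s i)))
  ... | no  i≢j  = sym (trans (between (s i) (s j) (λ e → i≢j (trans (sym (ps i)) (trans e (ps j)))))
                     (cong₂ (arc H) (ps i) (ps j)))

InLevel-transBlowup : ∀ {k n m} {H : Tournament n} {X : Tournament m} {p} → 1 ≤ k → InLevel k H →
  (∀ i → ∃[ x ] p x ≡ i) → TransBlowupMap X H p → InLevel k X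
InLevel-transBlowup {H = H} {X} {p} k≥1 H∈k surj blowup =
  InLevel-extension H∈k (section-embedding {X = X} {H} {p} blowup (proj₁ ∘ surj) (proj₂ ∘ surj))
    (InD-transBlowup k≥1 {H = H} (proj₁ H∈k) {X = X} {p} blowup)

orient : Bool → Bool → Bool
orient e c = not e xor c

orient-involutive : ∀ e c → orient e (orient e c) ≡ c
orient-involutive true  c = refl
orient-involutive false c = BoolP.not-involutive c

-- σ makes the new vertex a covertex (e = true) or a revertex (e = false) of w.
CRWitness : ∀ {n} → Tournament n → (Fin n → Bool) → Fin n → Bool → Set
CRWitness X σ w e = ∀ i → i ≢ w → σ i ≡ orient e (arc X w i)

CRWitness⇒CRVertex : ∀ {n} (X : Tournament n) σ {w} e → CRWitness X σ w e → CRVertex X σ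
CRWitness⇒CRVertex X σ {w} true  witness = w , inj₁ ((λ ()) , λ where
  zero    0≢0 _  → ⊥-elim (0≢0 refl)
  (suc i) _   ≢w → witness i (≢w ∘ cong suc))
CRWitness⇒CRVertex X σ {w} false witness = w , inj₂ ((λ ()) , λ where
  zero    0≢0 _  → ⊥-elim (0≢0 refl)
  (suc i) _   ≢w → witness i (≢w ∘ cong suc))

CRVertex⇒CRWitness : ∀ {n} (X : Tournament n) σ → CRVertex X σ → ∃₂ λ w e → CRWitness X σ w e
CRVertex⇒CRWitness X σ (w , inj₁ (_ , same)) = w , true  , λ i i≢w → same (suc i) (λ ()) (i≢w ∘ suc-injective)
CRVertex⇒CRWitness X σ (w , inj₂ (_ , opp))  = w , false , λ i i≢w → opp (suc i) (λ ()) (i≢w ∘ suc-injective)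

CRWitness? : ∀ {n} (X : Tournament n) σ → Dec (∃₂ λ w e → CRWitness X σ w e)
CRWitness? X σ = any? (λ w → witness-at w)
  where
  witness? : ∀ w e → Dec (CRWitness X σ w e)
  witness? w e = all? (λ i → ¬? (i ≟ w) →-dec (σ i BoolP.≟ orient e (arc X w i)))
  witness-at : ∀ w → Dec (∃[ e ] CRWitness X σ w e)
  witness-at w with witness? w true | witness? w false
  ... | yes c | _     = yes (true , c)
  ... | no _  | yes c = yes (false , c)
  ... | no ¬t | no ¬f = no λ { (true , c) → ¬t c ; (false , c) → ¬f c }

CRWitness-unique : ∀ {n} (H : Tournament (suc (suc n))) → (∀ u₁ u₂ → ¬ CRAssoc H u₁ u₂) →
  ∀ {σ j e j′ e′} → CRWitness H σ j e → CRWitness H σ j′ e′ → j ≡ j′ × e ≡ e′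
CRWitness-unique H basic {σ} {j} {e} {j′} {e′} c c′ with j ≟ j′
... | yes refl = refl , same-orientation (some-other j)
  where
  some-other : ∀ {n} (j : Fin (suc (suc n))) → ∃[ i ] i ≢ j
  some-other zero    = suc zero , λ ()
  some-other (suc _) = zero , λ ()
  same-orientation : ∃[ i ] i ≢ j → e ≡ e′
  same-orientation (i , i≢j) = orient-cancel e e′ (trans (sym (c i i≢j)) (c′ i i≢j))
    where
    orient-cancel : ∀ e e′ {x} → orient e x ≡ orient e′ x → e ≡ e′
    orient-cancel true  true  _ = refl
    orient-cancel false false _ = refl
    orient-cancel true  false {true}  ()
    orient-cancel true  false {false} ()
    orient-cancel false true  {true}  ()
    orient-cancel false true  {false} ()
... | no j≢j′ = ⊥-elim (basic j j′ (associated e e′ λ v v≢j v≢j′ → trans (sym (c v v≢j)) (c′ v v≢j′)))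
  where
  associated : ∀ e e′ → (∀ v → v ≢ j → v ≢ j′ → orient e (arc H j v) ≡ orient e′ (arc H j′ v)) →
    CRAssoc H j j′
  associated true  true  same = inj₁ (j≢j′ , same)
  associated false false same = inj₁ (j≢j′ , λ v v≢j v≢j′ → BoolP.not-injective (same v v≢j v≢j′))
  associated true  false same = inj₂ (j≢j′ , same)
  associated false true  same = inj₂ (j≢j′ , λ v v≢j v≢j′ →
    trans (sym (BoolP.not-involutive _)) (cong not (same v v≢j v≢j′)))

ExtensionsCR : ℕ → ∀ {n} → Tournament n → Set
ExtensionsCR k X = ∀ σ → InD k (extend X σ) → ∃₂ λ w e → CRWitness X σ w e

IsCR⇒ExtensionsCR : ∀ {k n} {X : Tournament (suc n)} → 4 ≤ n → Odd k → InLevel k X → IsCR X → ExtensionsCR k X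
IsCR⇒ExtensionsCR {X = X} n≥4 k-odd X∈k (k′ , k′-odd , X∈k′ , cr) σ extension∈D
  with InLevel-unique k′-odd k-odd X X∈k′ X∈k
... | refl with CRWitness? X σ
...   | yes witness = witness
...   | no ∄witness = ⊥-elim (large-CR {X = X} n≥4 cr σ (∄witness ∘ CRVertex⇒CRWitness X σ) extension∈D)
  where
  large-CR : ∀ {n} {X : Tournament (suc n)} {R : Set} → 4 ≤ n → (suc n ≡ 1 ⊎ suc n ≡ 2 ⊎ IsDiamond X ⊎ R) → R
  large-CR (s≤s (s≤s (s≤s (s≤s _)))) (inj₁ ())
  large-CR (s≤s (s≤s (s≤s (s≤s _)))) (inj₂ (inj₁ ()))
  large-CR (s≤s (s≤s (s≤s (s≤s _)))) (inj₂ (inj₂ (inj₁ (() , _))))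
  large-CR _                         (inj₂ (inj₂ (inj₂ r))) = r

ExtensionsCR⇒IsCR : ∀ {k n} {X : Tournament n} → Odd k → InLevel k X → ExtensionsCR k X → IsCR X
ExtensionsCR⇒IsCR {k} {X = X} k-odd X∈k extensions = k , k-odd , X∈k , inj₂ (inj₂ (inj₂ λ σ ¬CR extension∈D →
  let w , e , witness = extensions σ extension∈D in ¬CR (CRWitness⇒CRVertex X σ e witness)))

-- Transitive blowups of H have only CR extensions

extend-embedding : ∀ {n m} {X : Tournament n} {Y : Tournament m} (e : Embedding X Y) (σ : Fin m → Bool) →
  Embedding (extend X (σ ∘ Embedding.map e)) (extend Y σ)
extend-embedding {X = X} {Y} (embedding g g-inj g-arcs) σ = embedding g′ g′-inj arcs
  where
  g′ : Fin (suc _) → Fin (suc _)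
  g′ zero    = zero
  g′ (suc i) = suc (g i)
  g′-inj : ∀ {i j} → g′ i ≡ g′ j → i ≡ j
  g′-inj {zero}  {zero}  _ = refl
  g′-inj {suc i} {suc j} e = cong suc (g-inj (suc-injective e))
  g′-inj {zero}  {suc _} ()
  g′-inj {suc _} {zero}  ()
  arcs : ∀ i j → arc (extend X (σ ∘ g)) i j ≡ arc (extend Y σ) (g′ i) (g′ j)
  arcs zero    zero    = refl
  arcs zero    (suc j) = refl
  arcs (suc i) zero    = refl
  arcs (suc i) (suc j) = g-arcs i j

duplicateArcs : ∀ {n} → Tournament n → Fin n → Bool → Fin n → Bool
duplicateArcs H v b i = if does (i ≟ v) then b else arc H v i

-- The new vertex zero is a second copy of v, and b is the orientation of the arc from it to v.
duplicate : ∀ {n} → Tournament n → Fin n → Bool → Tournament (suc n)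
duplicate H v b = extend H (duplicateArcs H v b)

duplicateArcs-≢ : ∀ {n} (H : Tournament n) {v} b {i} → i ≢ v → duplicateArcs H v b i ≡ arc H v i
duplicateArcs-≢ H {v} b {i} i≢v = cong (if_then b else arc H v i) (dec-false (i ≟ v) i≢v)

duplicatePart : ∀ {n} → Fin n → Fin (suc n) → Fin n
duplicatePart v zero    = v
duplicatePart v (suc i) = i

transitive-within-pairs : ∀ {m n} (X : Tournament m) (q : Fin m → Fin n) →
  (∀ x y z → q x ≡ q y → q y ≡ q z → x ≡ y ⊎ y ≡ z ⊎ x ≡ z) →
  ∀ x y z → q x ≡ q y → q y ≡ q z → arc X x y ≡ true → arc X y z ≡ true → arc X x z ≡ true
transitive-within-pairs X q pairs x y z qx≡qy qy≡qz xy yz with pairs x y z qx≡qy qy≡qz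
... | inj₁ refl        = ⊥-elim (arc⇒≢ X xy refl)
... | inj₂ (inj₁ refl) = ⊥-elim (arc⇒≢ X yz refl)
... | inj₂ (inj₂ refl) = ⊥-elim (arc-asym X xy yz)

duplicatePart-pairs : ∀ {n} (v : Fin n) x y z → duplicatePart v x ≡ duplicatePart v y →
  duplicatePart v y ≡ duplicatePart v z → x ≡ y ⊎ y ≡ z ⊎ x ≡ z
duplicatePart-pairs v zero    zero    _       _  _  = inj₁ refl
duplicatePart-pairs v _       zero    zero    _  _  = inj₂ (inj₁ refl)
duplicatePart-pairs v zero    (suc j) zero    _  _  = inj₂ (inj₂ refl)
duplicatePart-pairs v (suc i) (suc j) _       e₁ _  = inj₁ (cong suc e₁)
duplicatePart-pairs v _       (suc j) (suc l) _  e₂ = inj₂ (inj₁ (cong suc e₂))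
duplicatePart-pairs v (suc i) zero    (suc l) e₁ e₂ = inj₂ (inj₂ (cong suc (trans e₁ e₂)))

duplicate-transBlowupMap : ∀ {n} (H : Tournament n) v b → TransBlowupMap (duplicate H v b) H (duplicatePart v)
duplicate-transBlowupMap H v b = between , transitive-within-pairs (duplicate H v b) (duplicatePart v) (duplicatePart-pairs v)
  where
  between : ∀ x y → duplicatePart v x ≢ duplicatePart v y →
    arc (duplicate H v b) x y ≡ arc H (duplicatePart v x) (duplicatePart v y)
  between zero    zero    v≢v = ⊥-elim (v≢v refl)
  between zero    (suc j) v≢j = duplicateArcs-≢ H b (v≢j ∘ sym)
  between (suc i) zero    i≢v = trans (cong not (duplicateArcs-≢ H b i≢v)) (sym (antisym H v i (i≢v ∘ sym)))
  between (suc i) (suc j) _   = refl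

duplicate-isOneTransBlowup : ∀ {n} (H : Tournament n) v b → IsOneTransBlowup (duplicate H v b) H
duplicate-isOneTransBlowup H v b = refl , duplicatePart v , (λ i → suc i , refl) , duplicate-transBlowupMap H v b

-- In extend (duplicate H v b) σ′ with σ′ giving both copies of v the same arc, the two copies are
-- covertices and deleting one of them leaves extend H σ.
ExtensionsCR-from-duplicate : ∀ {k n} → 1 ≤ k → (H : Tournament n) → ∀ v b →
  ExtensionsCR k (duplicate H v b) → ExtensionsCR k H
ExtensionsCR-from-duplicate {k} k≥1 H v b duplicate-CR σ extension∈D with duplicate-CR σ′ E∈D
  where
  σ′ : Fin (suc _) → Bool
  σ′ zero    = σ v
  σ′ (suc i) = σ i
  E : Tournament (suc (suc _))
  E = extend (duplicate H v b) σ′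
  copies : Covertices E (suc zero) (suc (suc v))
  copies = (λ ()) , λ where
    zero                _   _    → refl
    (suc zero)          1≢1 _    → ⊥-elim (1≢1 refl)
    (suc (suc i))       _   ≢v   → duplicateArcs-≢ H b (λ i≡v → ≢v (cong (λ x → suc (suc x)) i≡v))
  E∈D : InD k E
  E∈D = InD-undelete-covertex k≥1 E copies
    (InD-embedding k {T₁ = delete E (suc zero)} {T₂ = extend H σ} (embedding-pointwise λ where
    zero    zero    → refl
    zero    (suc j) → refl
    (suc i) zero    → refl
    (suc i) (suc j) → refl) extension∈D)
... | zero  , e , witness = v , e , λ i i≢v → trans (witness (suc i) (λ ())) (cong (orient e) (duplicateArcs-≢ H b i≢v))
... | suc w , e , witness = w , e , λ i i≢w → witness (suc i) (i≢w ∘ suc-injective)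

-- Let (j₀, e₀) be the CR witness of σ on a transversal of the parts.  Adding one further vertex z
-- gives a copy of a 1-transitive blowup of H, whose CR witness (unique, as H is basic) forces σ z
-- for z outside part j₀ and relates σ on any two vertices of part j₀.  Writing τ = orient e₀ ∘ σ,
-- the witness in T is then the last vertex of part j₀ with τ false, or the source of the part.
module _ {k n} (k≥1 : 1 ≤ k) (H : Tournament (suc (suc n))) (H-basic : ∀ u₁ u₂ → ¬ CRAssoc H u₁ u₂)
         (duplicates-CR : ∀ v b → ExtensionsCR k (duplicate H v b))
         {m} (T : Tournament m) (p : Fin m → Fin (suc (suc n))) (surj : ∀ i → ∃[ x ] p x ≡ i)
         (blowup : TransBlowupMap T H p) where

  private
    N : ℕ
    N = suc (suc n)
    between : ∀ x y → p x ≢ p y → arc T x y ≡ arc H (p x) (p y)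
    between = proj₁ blowup
    within : ∀ x y z → p x ≡ p y → p y ≡ p z → arc T x y ≡ true → arc T y z ≡ true → arc T x z ≡ true
    within = proj₂ blowup

    H-CR : ExtensionsCR k H
    H-CR = ExtensionsCR-from-duplicate k≥1 H zero true (duplicates-CR zero true)

    Transversal : (Fin N → Fin m) → Set
    Transversal t = ∀ i → p (t i) ≡ i

    transversal-embedding : ∀ {t} → Transversal t → Embedding H T
    transversal-embedding {t} = section-embedding {X = T} {H} {p} blowup t

    transversal-arcs : ∀ {t} → Transversal t → ∀ i j → arc T (t i) (t j) ≡ arc H i j
    transversal-arcs t-tr i j = sym (Embedding.arcs (transversal-embedding t-tr) i j)

    witness-unique : ∀ {τ j j′} e e′ → CRWitness H τ j e → CRWitness H τ j′ e′ → j ≡ j′ × e ≡ e′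
    witness-unique e e′ = CRWitness-unique H H-basic {e = e} {e′ = e′}

    module _ (σ : Fin m → Bool) (extension∈D : InD k (extend T σ)) where

      witness-on : ∀ {t} → Transversal t → ∃₂ λ j e → CRWitness H (σ ∘ t) j e
      witness-on t-tr = H-CR _ (InD-embedding k (extend-embedding (transversal-embedding t-tr) σ) extension∈D)

      module ExtraVertex {t} (t-tr : Transversal t) (z : Fin m) (z≢t : z ≢ t (p z)) where
        i₀ : Fin N
        i₀ = p z
        b : Bool
        b = arc T z (t i₀)

        t≢z : ∀ i → t i ≢ z
        t≢z i e = z≢t (trans (sym e) (cong t (trans (sym (t-tr i)) (cong p e))))

        z-arcs : ∀ j → duplicateArcs H i₀ b j ≡ arc T z (t j)
        z-arcs j = by-cases (j ≟ i₀)
          where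
          by-cases : Dec (j ≡ i₀) → duplicateArcs H i₀ b j ≡ arc T z (t j)
          by-cases (yes refl) = cong (if_then b else arc H i₀ i₀) (dec-true (i₀ ≟ i₀) refl)
          by-cases (no j≢i₀) = trans (duplicateArcs-≢ H b j≢i₀)
            (sym (trans (between z (t j) (λ e → j≢i₀ (trans (sym (t-tr j)) (sym e)))) (cong (arc H i₀) (t-tr j))))

        copy : Embedding (duplicate H i₀ b) T
        copy = embedding g g-inj arcs
          where
          g : Fin (suc N) → Fin m
          g zero    = z
          g (suc i) = t i
          g-inj : ∀ {i j} → g i ≡ g j → i ≡ j
          g-inj {zero}  {zero}  _ = refl
          g-inj {zero}  {suc j} e = ⊥-elim (t≢z j (sym e))
          g-inj {suc i} {zero}  e = ⊥-elim (t≢z i e)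
          g-inj {suc i} {suc j} e = cong suc (Embedding.injective (transversal-embedding t-tr) e)
          arcs : ∀ i j → arc (duplicate H i₀ b) i j ≡ arc T (g i) (g j)
          arcs zero    zero    = sym (irrefl T z)
          arcs zero    (suc j) = z-arcs j
          arcs (suc i) zero    = trans (cong not (z-arcs i)) (sym (antisym T z (t i) (t≢z i ∘ sym)))
          arcs (suc i) (suc j) = sym (transversal-arcs t-tr i j)

        σ′ : Fin (suc N) → Bool
        σ′ = σ ∘ Embedding.map copy

        witness : ∃₂ λ w e → CRWitness (duplicate H i₀ b) σ′ w e
        witness = duplicates-CR i₀ b σ′ (InD-embedding k (extend-embedding copy σ) extension∈D)

        witness-at-copy : ∀ {i e} → CRWitness (duplicate H i₀ b) σ′ (suc i) e →
          CRWitness H (σ ∘ t) i e × σ z ≡ orient e (not (arc T z (t i)))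
        witness-at-copy {i} {e} c =
          (λ i′ i′≢i → c (suc i′) (i′≢i ∘ suc-injective)) , trans (c zero (λ ())) (cong (orient e ∘ not) (z-arcs i))

        witness-at-new : ∀ {e} → CRWitness (duplicate H i₀ b) σ′ zero e →
          CRWitness H (σ ∘ t) i₀ e × (∀ i → σ (t i) ≡ orient e (arc T z (t i)))
        witness-at-new {e} c =
          (λ i i≢i₀ → trans (c (suc i) (λ ())) (cong (orient e) (duplicateArcs-≢ H b i≢i₀))) ,
          (λ i → trans (c (suc i) (λ ())) (cong (orient e) (z-arcs i)))

      s : Fin N → Fin m
      s = proj₁ ∘ surj

      s-tr : Transversal s
      s-tr = proj₂ ∘ surj

      module AroundWitness (j₀ : Fin N) (e₀ : Bool) (c₀ : CRWitness H (σ ∘ s) j₀ e₀) where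

        outside-arc : ∀ {z} → p z ≢ j₀ → not (arc T z (s j₀)) ≡ arc H j₀ (p z)
        outside-arc {z} pz≢j₀ = trans (sym (antisym T z (s j₀) z≢sj₀))
          (trans (between (s j₀) z (λ e → pz≢j₀ (trans (sym e) (s-tr j₀)))) (cong (λ x → arc H x (p z)) (s-tr j₀)))
          where
          z≢sj₀ : z ≢ s j₀
          z≢sj₀ e = pz≢j₀ (trans (cong p e) (s-tr j₀))

        outside-part : ∀ z → p z ≢ j₀ → σ z ≡ orient e₀ (arc H j₀ (p z))
        outside-part z pz≢j₀ with z ≟ s (p z)
        ... | yes z≡s = trans (cong σ z≡s) (c₀ (p z) pz≢j₀)
        ... | no  z≢s with ExtraVertex.witness s-tr z z≢s
        ...   | zero , e , c =
          ⊥-elim (pz≢j₀ (proj₁ (witness-unique e e₀ (proj₁ (ExtraVertex.witness-at-new s-tr z z≢s {e} c)) c₀)))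
        ...   | suc i , e , c with ExtraVertex.witness-at-copy s-tr z z≢s {i} {e} c
        ...     | c-i , σz with witness-unique e e₀ c-i c₀
        ...       | refl , refl = trans σz (cong (orient e₀) (outside-arc pz≢j₀))

        module Through (z : Fin m) (pz≡j₀ : p z ≡ j₀) where
          t : Fin N → Fin m
          t i = if does (i ≟ j₀) then z else s i

          t-j₀ : t j₀ ≡ z
          t-j₀ = cong (if_then z else s j₀) (dec-true (j₀ ≟ j₀) refl)

          t-≢ : ∀ {i} → i ≢ j₀ → t i ≡ s i
          t-≢ {i} i≢j₀ = cong (if_then z else s i) (dec-false (i ≟ j₀) i≢j₀)

          t-tr : Transversal t
          t-tr i = by-cases (i ≟ j₀)
            where
            by-cases : Dec (i ≡ j₀) → p (t i) ≡ i
            by-cases (yes refl) = trans (cong p t-j₀) pz≡j₀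
            by-cases (no i≢j₀)  = trans (cong p (t-≢ i≢j₀)) (s-tr i)

          c₀′ : CRWitness H (σ ∘ t) j₀ e₀
          c₀′ i i≢j₀ = trans (cong σ (t-≢ i≢j₀)) (c₀ i i≢j₀)

          other≢t : ∀ {z′} → p z′ ≡ j₀ → z ≢ z′ → z′ ≢ t (p z′)
          other≢t pz′≡j₀ z≢z′ e = z≢z′ (sym (trans e (trans (cong t pz′≡j₀) t-j₀)))

          inside-part : ∀ {z′} → p z′ ≡ j₀ → z ≢ z′ →
            σ z′ ≡ orient e₀ (arc T z z′) ⊎ σ z ≡ orient e₀ (arc T z′ z)
          inside-part {z′} pz′≡j₀ z≢z′ with ExtraVertex.witness t-tr z′ (other≢t pz′≡j₀ z≢z′)
          ... | suc i , e , c with ExtraVertex.witness-at-copy t-tr z′ (other≢t pz′≡j₀ z≢z′) {i} {e} c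
          ...   | c-i , σz′ with witness-unique e e₀ c-i c₀′
          ...     | refl , refl = inj₁ (trans σz′ (cong (orient e₀)
                      (trans (cong (λ x → not (arc T z′ x)) t-j₀) (sym (antisym T z′ z (z≢z′ ∘ sym))))))
          inside-part {z′} pz′≡j₀ z≢z′ | zero , e , c
            with ExtraVertex.witness-at-new t-tr z′ (other≢t pz′≡j₀ z≢z′) {e} c
          ...   | c-new , σt with witness-unique e e₀ c-new c₀′
          ...     | _ , refl = inj₂ (trans (cong σ (sym t-j₀)) (trans (σt j₀) (cong (λ x → orient e₀ (arc T z′ x)) t-j₀)))

        τ : Fin m → Bool
        τ z = orient e₀ (σ z)

        Centre : Set
        Centre = ∃[ w ] p w ≡ j₀ × (∀ z → p z ≡ j₀ → z ≢ w → τ z ≡ arc T w z)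

        last-dissenter : ∀ {z} → p z ≡ j₀ → τ z ≡ false → Centre
        last-dissenter {z} pz≡j₀ τz with minimal-element (λ x → (p x ≟ j₀) ×-dec (τ x BoolP.≟ false))
          (λ x y → arc T y x) (irrefl T)
          (λ (px , _) (py , _) (pz , _) yx zy → within _ _ _ (trans pz (sym py)) (trans py (sym px)) zy yx)
          (pz≡j₀ , τz)
        ... | w , (pw≡j₀ , τw) , w-last = w , pw≡j₀ , centred
          where
          centred : ∀ z → p z ≡ j₀ → z ≢ w → τ z ≡ arc T w z
          centred z pz≡j₀ z≢w with τ z in τz
          ... | false = sym (w-last z (pz≡j₀ , τz))
          ... | true with Through.inside-part w pw≡j₀ pz≡j₀ (z≢w ∘ sym)
          ...   | inj₁ σz = trans (sym τz) (trans (cong (orient e₀) σz) (orient-involutive e₀ (arc T w z)))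
          ...   | inj₂ σw = sym (trans (antisym T z w z≢w) (cong not
                  (trans (sym (orient-involutive e₀ (arc T z w))) (trans (cong (orient e₀) (sym σw)) τw))))

        source : (∀ z → p z ≡ j₀ → τ z ≡ true) → Centre
        source all-true with minimal-element (λ x → p x ≟ j₀) (arc T) (irrefl T)
          (λ px py pz → within _ _ _ (trans px (sym py)) (trans py (sym pz)))
          (s-tr j₀)
        ... | w , pw≡j₀ , w-source = w , pw≡j₀ , λ z pz≡j₀ z≢w →
          trans (all-true z pz≡j₀) (sym (trans (antisym T z w z≢w) (cong not (w-source z pz≡j₀))))

        centre : Centre
        centre with any? (λ z → (p z ≟ j₀) ×-dec (τ z BoolP.≟ false))
        ... | yes (z , pz≡j₀ , τz) = last-dissenter pz≡j₀ τz
        ... | no ∄dissenter = source λ z pz≡j₀ → BoolP.¬-not (λ τz → ∄dissenter (z , pz≡j₀ , τz))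

        witness-at-centre : Centre → ∃₂ λ w e → CRWitness T σ w e
        witness-at-centre (w , pw≡j₀ , centred) = w , e₀ , agrees
          where
          agrees : ∀ z → z ≢ w → σ z ≡ orient e₀ (arc T w z)
          agrees z z≢w with p z ≟ j₀
          ... | yes pz≡j₀ = trans (sym (orient-involutive e₀ (σ z))) (cong (orient e₀) (centred z pz≡j₀ z≢w))
          ... | no  pz≢j₀ = trans (outside-part z pz≢j₀) (cong (orient e₀) (sym
                  (trans (between w z (λ e → pz≢j₀ (trans (sym e) pw≡j₀))) (cong (λ x → arc H x (p z)) pw≡j₀))))

      witness : ∃₂ λ w e → CRWitness T σ w e
      witness with witness-on s-tr
      ... | j₀ , e₀ , c₀ = AroundWitness.witness-at-centre j₀ e₀ c₀ (AroundWitness.centre j₀ e₀ c₀)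

  ExtensionsCR-transBlowup : ExtensionsCR k T
  ExtensionsCR-transBlowup = witness

-- Switching equivalence to transitive blowups

transBlowupMap-pointwise : ∀ {m n} {X Y : Tournament m} {H : Tournament n} {q} →
  (∀ i j → arc X i j ≡ arc Y i j) → TransBlowupMap X H q → TransBlowupMap Y H q
transBlowupMap-pointwise arcs (between , within) =
  (λ x y qx≢qy → trans (sym (arcs x y)) (between x y qx≢qy)) ,
  (λ x y z qx≡qy qy≡qz xy yz → trans (sym (arcs x z)) (within x y z qx≡qy qy≡qz (trans (arcs x y) xy) (trans (arcs y z) yz)))

embedding-transBlowupMap : ∀ {m n} {X : Tournament m} {H : Tournament n} (e : Embedding X H) →
  TransBlowupMap X H (Embedding.map e)
embedding-transBlowupMap {X = X} (embedding q q-inj arcs) =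
  (λ x y _ → arcs x y) , (λ x y z qx≡qy _ xy _ → ⊥-elim (arc⇒≢ X xy (q-inj qx≡qy)))

transBlowupMap-∘ : ∀ {l m n} {X : Tournament l} {B : Tournament m} {H : Tournament n} {r q} →
  TransBlowupMap X B r → TransBlowupMap B H q → TransBlowupMap X H (q ∘ r)
transBlowupMap-∘ {X = X} {B} {H} {r} {q} (betweenᵣ , withinᵣ) (between_q , within_q) = between , within
  where
  between : ∀ x y → q (r x) ≢ q (r y) → arc X x y ≡ arc H (q (r x)) (q (r y))
  between x y ne = trans (betweenᵣ x y (ne ∘ cong q)) (between_q (r x) (r y) ne)
  B-arc : ∀ {x y} → r x ≢ r y → arc X x y ≡ true → arc B (r x) (r y) ≡ true
  B-arc {x} {y} rx≢ry xy = trans (sym (betweenᵣ x y rx≢ry)) xy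
  within : ∀ x y z → q (r x) ≡ q (r y) → q (r y) ≡ q (r z) → arc X x y ≡ true → arc X y z ≡ true → arc X x z ≡ true
  within x y z e₁ e₂ xy yz with r x ≟ r y | r y ≟ r z
  ... | yes rx≡ry | yes ry≡rz = withinᵣ x y z rx≡ry ry≡rz xy yz
  ... | yes rx≡ry | no  ry≢rz = trans (betweenᵣ x z (λ e → ry≢rz (trans (sym rx≡ry) e)))
          (trans (cong (λ u → arc B u (r z)) rx≡ry) (trans (sym (betweenᵣ y z ry≢rz)) yz))
  ... | no  rx≢ry | yes ry≡rz = trans (betweenᵣ x z (λ e → rx≢ry (trans e (sym ry≡rz))))
          (trans (cong (arc B (r x)) (sym ry≡rz)) (trans (sym (betweenᵣ x y rx≢ry)) xy))
  ... | no  rx≢ry | no  ry≢rz with r x ≟ r z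
  ...   | yes rx≡rz = ⊥-elim (arc-asym B (B-arc rx≢ry xy) (trans (cong (arc B (r y)) rx≡rz) (B-arc ry≢rz yz)))
  ...   | no  rx≢rz = trans (betweenᵣ x z rx≢rz) (within_q (r x) (r y) (r z) e₁ e₂
          (B-arc rx≢ry xy) (B-arc ry≢rz yz))

extend-copying : ∀ {m} (B : Tournament m) {τ : Fin m → Bool} {w} → (∀ j → j ≢ w → τ j ≡ arc B w j) →
  ∀ i j → arc (duplicate B w (τ w)) i j ≡ arc (extend B τ) i j
extend-copying B {τ} {w} copies = arcs
  where
  new-arcs : ∀ j → duplicateArcs B w (τ w) j ≡ τ j
  new-arcs j = by-cases (j ≟ w)
    where
    by-cases : Dec (j ≡ w) → duplicateArcs B w (τ w) j ≡ τ j
    by-cases (yes refl) = cong (Data.Bool.if_then τ w else arc B w w) (dec-true (w ≟ w) refl)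
    by-cases (no j≢w)   = trans (duplicateArcs-≢ B (τ w) j≢w) (sym (copies j j≢w))
  arcs : ∀ i j → arc (duplicate B w (τ w)) i j ≡ arc (extend B τ) i j
  arcs zero    zero    = refl
  arcs zero    (suc j) = new-arcs j
  arcs (suc i) zero    = cong not (new-arcs i)
  arcs (suc i) (suc j) = refl

SwEqTransBlowup-permute : ∀ {m n} (T : Tournament m) {H : Tournament n} (π : Permutation m m) (W : Fin m → Bool)
  {Y : Tournament m} → (∀ i j → arc Y i j ≡ (W i xor W j) xor arc T (π ⟨$⟩ʳ i) (π ⟨$⟩ʳ j)) →
  IsTransBlowup Y H → SwEqTransBlowup T H
SwEqTransBlowup-permute T {H} π W {Y} Y-arcs (p , surj , blowup) =
  W ∘ (π ⟨$⟩ˡ_) , p ∘ (π ⟨$⟩ˡ_) , surj′ ,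
  transBlowupMap-pointwise {X = induced Y (π ⟨$⟩ˡ_) from-inj} {switch T (W ∘ (π ⟨$⟩ˡ_))} {H} {p ∘ (π ⟨$⟩ˡ_)} arcs
    (transBlowupMap-induced {X = Y} {H} {p} blowup (π ⟨$⟩ˡ_) from-inj)
  where
  from-inj : Injective _≡_ _≡_ (π ⟨$⟩ˡ_)
  from-inj {x} {y} e = trans (sym (inverseʳ π)) (trans (cong (π ⟨$⟩ʳ_) e) (inverseʳ π))
  surj′ : ∀ i → ∃[ y ] p (π ⟨$⟩ˡ y) ≡ i
  surj′ i = π ⟨$⟩ʳ proj₁ (surj i) , trans (cong p (inverseˡ π)) (proj₂ (surj i))
  arcs : ∀ x y → arc Y (π ⟨$⟩ˡ x) (π ⟨$⟩ˡ y) ≡ arc (switch T (W ∘ (π ⟨$⟩ˡ_))) x y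
  arcs x y = trans (Y-arcs _ _)
    (cong₂ (λ u v → (W (π ⟨$⟩ˡ x) xor W (π ⟨$⟩ˡ y)) xor arc T u v) (inverseʳ π) (inverseʳ π))

module _ {m n} {T : Tournament m} {H : Tournament n} (f : Fin n → Fin m) (f-inj : Injective _≡_ _≡_ f)
         (W₀ : Fin n → Bool) (π : Fin n ↔ Fin n)
         (iso : ∀ i j → arc H (Inverse.to π i) (Inverse.to π j) ≡ arc (switch (induced T f f-inj) W₀) i j) where

  SwEqTransBlowup-onto : (∀ y → ∃[ x ] f x ≡ y) → SwEqTransBlowup T H
  SwEqTransBlowup-onto onto = W , p , surj , embedding-transBlowupMap {X = switch T W} {H} (embedding p p-inj arcs)
    where
    h : Fin m → Fin n
    h = proj₁ ∘ onto
    fh : ∀ y → f (h y) ≡ y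
    fh = proj₂ ∘ onto
    W : Fin m → Bool
    W = W₀ ∘ h
    p : Fin m → Fin n
    p = Inverse.to π ∘ h
    p-inj : Injective _≡_ _≡_ p
    p-inj {y} {y′} e = trans (sym (fh y)) (trans (cong f (trans (sym (Inverse.inverseʳ π refl))
      (trans (cong (Inverse.from π) e) (Inverse.inverseʳ π refl)))) (fh y′))
    surj : ∀ i → ∃[ y ] p y ≡ i
    surj i = f (Inverse.from π i) , trans (cong (Inverse.to π) (f-inj (fh _))) (Inverse.inverseˡ π refl)
    arcs : ∀ y y′ → arc (switch T W) y y′ ≡ arc H (p y) (p y′)
    arcs y y′ = trans (cong₂ (λ u v → (W y xor W y′) xor arc T u v) (sym (fh y)) (sym (fh y′))) (sym (iso (h y) (h y′)))

Xi-delete : ∀ {m n} {H : Tournament n} (T : Tournament (suc m)) v (xi : Xi H T) → (∀ x → proj₁ xi x ≢ v) →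
  Xi H (delete T v)
Xi-delete T v (f , f-inj , W₀ , π , iso) f≢v = f′ , f′-inj , W₀ , π , λ i j → trans (iso i j)
  (cong₂ (λ a b → (W₀ i xor W₀ j) xor arc T a b) (sym (punchIn-punchOut (v≢f i))) (sym (punchIn-punchOut (v≢f j))))
  where
  v≢f : ∀ x → v ≢ f x
  v≢f x = f≢v x ∘ sym
  f′ : _ → _
  f′ x = punchOut (v≢f x)
  f′-inj : Injective _≡_ _≡_ f′
  f′-inj {x} {y} = f-inj ∘ punchOut-injective (v≢f x) (v≢f y)

module _ {k n} (k≥1 : 1 ≤ k) (H : Tournament (suc (suc n))) (H-basic : ∀ u₁ u₂ → ¬ CRAssoc H u₁ u₂)
         (duplicates-CR : ∀ v b → ExtensionsCR k (duplicate H v b)) where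

  -- With v moved to the front, T switched by W′ on the other vertices is an extension of the blowup
  -- of H found for T − v; the CR witness w of that extension makes v, after possibly switching it,
  -- a second copy of w.
  SwEqTransBlowup-add-vertex : ∀ {m} (T : Tournament (suc m)) v → InD k T →
    SwEqTransBlowup (delete T v) H → SwEqTransBlowup T H
  SwEqTransBlowup-add-vertex {m} T v T∈D (W′ , p′ , surj′ , blowup′) =
    SwEqTransBlowup-permute T {H} π W* {duplicate B′ w b} (λ i j → trans (extend-copying B′ copies i j) (moved (not e) i j))
      (p′ ∘ duplicatePart w , (λ i → suc (proj₁ (surj′ i)) , proj₂ (surj′ i)) ,
       transBlowupMap-∘ {X = duplicate B′ w b} {B′} {H} (duplicate-transBlowupMap B′ w b) blowup′)
    where
    B′ : Tournament m
    B′ = switch (delete T v) W′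
    π : Permutation (suc m) (suc m)
    π = insert zero v id
    π-inj : Injective _≡_ _≡_ (π ⟨$⟩ʳ_)
    π-inj {x} {y} e = trans (sym (inverseˡ π)) (trans (cong (π ⟨$⟩ˡ_) e) (inverseˡ π))
    σ : Fin m → Bool
    σ j = W′ j xor arc T v (punchIn v j)
    cons : Bool → Fin (suc m) → Bool
    cons c zero    = c
    cons c (suc j) = W′ j
    flip-arc : ∀ c w a → not (c xor (w xor a)) ≡ (w xor c) xor not a
    flip-arc true  true  true  = refl
    flip-arc true  true  false = refl
    flip-arc true  false true  = refl
    flip-arc true  false false = refl
    flip-arc false true  true  = refl
    flip-arc false true  false = refl
    flip-arc false false true  = refl
    flip-arc false false false = refl
    moved : ∀ c i j →
      arc (extend B′ (λ j → c xor σ j)) i j ≡ (cons c i xor cons c j) xor arc T (π ⟨$⟩ʳ i) (π ⟨$⟩ʳ j)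
    moved c zero    zero    = sym (cong₂ _xor_ (BoolP.xor-same c) (irrefl T v))
    moved c zero    (suc j) = sym (BoolP.xor-assoc c (W′ j) _)
    moved c (suc i) zero    = trans (flip-arc c (W′ i) _)
      (cong ((W′ i xor c) xor_) (sym (antisym T v (punchIn v i) (punchInᵢ≢i v i ∘ sym))))
    moved c (suc i) (suc j) = refl
    T″ : Tournament (suc m)
    T″ = induced T (π ⟨$⟩ʳ_) π-inj
    extension∈D : InD k (extend B′ σ)
    extension∈D = InD-embedding k {T₁ = extend B′ σ} {T₂ = switch T″ (cons false)} (embedding-pointwise (moved false))
      (InD-switch k T″ (cons false) (InD-embedding k (induced-embedding T (π ⟨$⟩ʳ_) π-inj) T∈D))
    witness : ∃₂ λ w e → CRWitness B′ σ w e
    witness = ExtensionsCR-transBlowup k≥1 H H-basic duplicates-CR B′ p′ surj′ blowup′ σ extension∈D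
    w : Fin m
    w = proj₁ witness
    e b : Bool
    e = proj₁ (proj₂ witness)
    b = orient e (σ w)
    W* : Fin (suc m) → Bool
    W* = cons (not e)
    copies : ∀ j → j ≢ w → orient e (σ j) ≡ arc B′ w j
    copies j j≢w = trans (cong (orient e) (proj₂ (proj₂ witness) j j≢w)) (orient-involutive e _)

  SwEqTransBlowup-from-Xi : ∀ {m} (T : Tournament m) → Xi H T → InD k T → SwEqTransBlowup T H
  SwEqTransBlowup-from-Xi {zero} T (f , f-inj , W₀ , π , iso) _ = SwEqTransBlowup-onto {T = T} {H} f f-inj W₀ π iso λ ()
  SwEqTransBlowup-from-Xi {suc m} T xi@(f , f-inj , W₀ , π , iso) T∈D with all? (λ y → any? (λ x → f x ≟ y))
  ... | yes onto = SwEqTransBlowup-onto {T = T} {H} f f-inj W₀ π iso onto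
  ... | no ¬onto with ¬∀⟶∃¬ (suc m) _ (λ y → any? (λ x → f x ≟ y)) ¬onto
  ...   | v , v∉f = SwEqTransBlowup-add-vertex T v T∈D (SwEqTransBlowup-from-Xi (delete T v)
          (Xi-delete {H = H} T v xi (λ x fx≡v → v∉f (x , fx≡v)))
          (InD-embedding k (induced-embedding T (punchIn v) (punchIn-injective v _ _)) T∈D))

-- The three conditions

IsTransBlowup-refl : ∀ {n} (H : Tournament n) → IsTransBlowup H H
IsTransBlowup-refl H =
  (λ x → x) , (λ i → i , refl) , embedding-transBlowupMap {X = H} {H} (embedding (λ x → x) (λ e → e) (λ _ _ → refl))

InLevel-unswitch : ∀ {k n} (T : Tournament n) W → InLevel k (switch T W) → InLevel k T
InLevel-unswitch {k} T W (switch∈D , inj₁ k≡1)     = InD-unswitch k T W switch∈D , inj₁ k≡1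
InLevel-unswitch {k} T W (switch∈D , inj₂ switch∉D) = InD-unswitch k T W switch∈D , inj₂ (switch∉D ∘ InD-switch (k ∸ 2) T W)

embedding⇒Xi : ∀ {m n} {H : Tournament n} {T : Tournament m} → Embedding H T → Xi H T
embedding⇒Xi (embedding g g-inj g-arcs) = g , g-inj , (λ _ → false) , ↔-id _ , g-arcs

xor-cancel : ∀ x y w c d → (x xor w) xor c ≡ (y xor w) xor d → c ≡ (x xor y) xor d
xor-cancel true  true  true  c d h = h
xor-cancel true  true  false c d h = BoolP.not-injective h
xor-cancel true  false true  c d h = h
xor-cancel true  false false c d h = trans (sym (BoolP.not-involutive c)) (cong not h)
xor-cancel false true  true  c d h = trans (sym (BoolP.not-involutive c)) (cong not h)
xor-cancel false true  false c d h = h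
xor-cancel false false true  c d h = BoolP.not-injective h
xor-cancel false false false c d h = h

switch-covertices⇒CRAssoc : ∀ {n} (X : Tournament n) W {a b} → Covertices (switch X W) a b → CRAssoc X a b
switch-covertices⇒CRAssoc X W {a} {b} (a≢b , same) with W a xor W b in Wab
... | false = inj₁ (a≢b , λ v v≢a v≢b →
  trans (xor-cancel (W a) (W b) (W v) _ _ (same v v≢a v≢b)) (cong (_xor arc X b v) Wab))
... | true  = inj₂ (a≢b , λ v v≢a v≢b →
  trans (xor-cancel (W a) (W b) (W v) _ _ (same v v≢a v≢b)) (cong (_xor arc X b v) Wab))

covertices-pointwise : ∀ {n} {X Y : Tournament n} → (∀ i j → arc X i j ≡ arc Y i j) →
  ∀ {a b} → Covertices X a b → Covertices Y a b
covertices-pointwise arcs (a≢b , same) = a≢b , λ v v≢a v≢b → trans (sym (arcs _ v)) (trans (same v v≢a v≢b) (arcs _ v))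

-- Two vertices of the copy in one part would be covertices of the copy, a switch of H.
copy-parts-injective : ∀ {m n} {Y : Tournament m} {H : Tournament n} {q} → (∀ u₁ u₂ → ¬ CRAssoc H u₁ u₂) →
  TransBlowupMap Y H q → (g : Fin n → Fin m) (g-inj : Injective _≡_ _≡_ g) (W : Fin n → Bool) →
  (∀ i j → arc Y (g i) (g j) ≡ (W i xor W j) xor arc H i j) → Injective _≡_ _≡_ (q ∘ g)
copy-parts-injective {Y = Y} {H} {q} H-basic blowup g g-inj W copy {i} {j} qgi≡qgj with i ≟ j
... | yes i≡j = i≡j
... | no  i≢j with covertex-in-part {X = induced Y g g-inj} {H} {q ∘ g}
                   (transBlowupMap-induced {X = Y} {H} {q} blowup g g-inj) i≢j qgi≡qgj
...   | b , _ , covertex = ⊥-elim (H-basic i b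
  (switch-covertices⇒CRAssoc H W (covertices-pointwise {X = induced Y g g-inj} {switch H W} copy covertex)))

module Conditions {k n} (k≥1 : 1 ≤ k) (k-odd : Odd k) (H : Tournament (suc (suc n))) (H-level : InLevel k H)
         (n≥2 : 2 ≤ n) (H-basic : ∀ u₁ u₂ → ¬ CRAssoc H u₁ u₂) where

  Characterisation : Set
  Characterisation = ∀ {m} (T : Tournament m) → (Xi H T × InLevel k T) ⇔ SwEqTransBlowup T H

  SwEqTransBlowup⇒Xi×InLevel : ∀ {m} {T : Tournament m} → SwEqTransBlowup T H → Xi H T × InLevel k T
  SwEqTransBlowup⇒Xi×InLevel {T = T} (W , p , surj , blowup) =
    (s , Embedding.injective copy , W ∘ s , ↔-id _ , Embedding.arcs copy) ,
    InLevel-unswitch T W (InLevel-transBlowup {H = H} {X = switch T W} {p} k≥1 H-level surj blowup)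
    where
    s : Fin (suc (suc n)) → Fin _
    s = proj₁ ∘ surj
    copy : Embedding H (switch T W)
    copy = section-embedding {X = switch T W} {H} {p} blowup s (proj₂ ∘ surj)

  duplicates-ExtensionsCR : (∀ v b → IsCR (duplicate H v b)) → ∀ v b → ExtensionsCR k (duplicate H v b)
  duplicates-ExtensionsCR duplicates-CR v b = IsCR⇒ExtensionsCR (s≤s (s≤s n≥2)) k-odd
    (InLevel-transBlowup {H = H} {X = duplicate H v b} {duplicatePart v} k≥1 H-level (λ i → suc i , refl)
      (duplicate-transBlowupMap H v b))
    (duplicates-CR v b)

  transBlowups-CR : (∀ v b → IsCR (duplicate H v b)) → AllTransBlowupsCR H
  transBlowups-CR duplicates-CR T (p , surj , blowup) =
    ExtensionsCR⇒IsCR k-odd (InLevel-transBlowup {H = H} {X = T} {p} k≥1 H-level surj blowup)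
      (ExtensionsCR-transBlowup k≥1 H H-basic (duplicates-ExtensionsCR duplicates-CR) T p surj blowup)

  characterisation : (∀ v b → IsCR (duplicate H v b)) → Characterisation
  characterisation duplicates-CR T = mk⇔
    (λ (xi , T-level) → SwEqTransBlowup-from-Xi k≥1 H H-basic (duplicates-ExtensionsCR duplicates-CR) T xi (proj₁ T-level))
    (SwEqTransBlowup⇒Xi×InLevel {T = T})

  transBlowups-CR-from-characterisation : Characterisation → AllTransBlowupsCR H
  transBlowups-CR-from-characterisation char T (p , surj , blowup) = ExtensionsCR⇒IsCR k-odd T-level extensions
    where
    T-level : InLevel k T
    T-level = InLevel-transBlowup {H = H} {X = T} {p} k≥1 H-level surj blowup
    s : Fin (suc (suc n)) → Fin _
    s = proj₁ ∘ surj
    copy : Embedding H T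
    copy = section-embedding {X = T} {H} {p} blowup s (proj₂ ∘ surj)
    copy′ : ∀ σ → Embedding H (extend T σ)
    copy′ σ = embedding (suc ∘ s) (Embedding.injective copy ∘ suc-injective) (Embedding.arcs copy)
    -- The new vertex either shares its part with an old vertex, which makes it a CR vertex, or is alone
    -- in its part, and then the copy of H lies in the other parts, two of its vertices in one part.
    extensions : ExtensionsCR k T
    extensions σ extension∈D
      with Equivalence.to (char (extend T σ)) (embedding⇒Xi (copy′ σ) , InLevel-extension H-level (copy′ σ) extension∈D)
    ... | W , q , _ , q-blowup with any? (λ y → ¬? (y ≟ zero) ×-dec (q y ≟ q zero))
    ...   | yes (y , y≢0 , qy≡q0) with covertex-in-part {X = switch (extend T σ) W} {H} {q} q-blowup (y≢0 ∘ sym) (sym qy≡q0)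
    ...     | zero  , _ , (0≢0 , _) = ⊥-elim (0≢0 refl)
    ...     | suc w , _ , covertex = CRVertex⇒CRWitness T σ (w , switch-covertices⇒CRAssoc (extend T σ) W covertex)
    extensions σ extension∈D | W , q , _ , q-blowup | no alone =
      ⊥-elim (<⇒notInjective (ℕP.n<1+n (suc n)) squeezed)
      where
      copy-parts : Injective _≡_ _≡_ (q ∘ Embedding.map (copy′ σ))
      copy-parts = copy-parts-injective {Y = switch (extend T σ) W} {H} {q} H-basic q-blowup
        (Embedding.map (copy′ σ)) (Embedding.injective (copy′ σ)) (W ∘ suc ∘ s)
        (λ i j → cong ((W (suc (s i)) xor W (suc (s j))) xor_) (sym (Embedding.arcs copy i j)))
      avoids : ∀ i → q zero ≢ q (suc (s i))
      avoids i e = alone (suc (s i) , (λ ()) , sym e)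
      squeezed : Injective _≡_ _≡_ (λ i → punchOut (avoids i))
      squeezed {i} {j} e = copy-parts (punchOut-injective (avoids i) (avoids j) e)

theorem5p1 : (k : ℕ) → 3 ≤ k → Odd k →
    ∀ {n} (H : Tournament n) → InLevel k H → IsBasic H →
    (IsStrongCR H ⇔ AllTransBlowupsCR H) ×
    (AllTransBlowupsCR H ⇔
      (∀ {m} (T : Tournament m) → (Xi H T × InLevel k T) ⇔ SwEqTransBlowup T H))
theorem5p1 k k≥3 k-odd H H-level (s≤s (s≤s n≥2) , H-basic) =
  mk⇔ (transBlowups-CR ∘ duplicates-of-strong) strong-of-all ,
  mk⇔ (characterisation ∘ duplicates-of-all) transBlowups-CR-from-characterisation
  where
  open Conditions (ℕP.≤-trans (s≤s z≤n) k≥3) k-odd H H-level n≥2 H-basic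
  duplicates-of-strong : IsStrongCR H → ∀ v b → IsCR (duplicate H v b)
  duplicates-of-strong (_ , one-blowups-CR) v b = one-blowups-CR (duplicate H v b) (duplicate-isOneTransBlowup H v b)
  duplicates-of-all : AllTransBlowupsCR H → ∀ v b → IsCR (duplicate H v b)
  duplicates-of-all all-CR v b = all-CR (duplicate H v b) (proj₂ (duplicate-isOneTransBlowup H v b))
  strong-of-all : AllTransBlowupsCR H → IsStrongCR H
  strong-of-all all-CR = all-CR H (IsTransBlowup-refl H) , λ T one-blowup → all-CR T (proj₂ one-blowup)
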